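{- Let $r\ge3$ and let $Q$ be a collectable $(r-1)$-pattern. Let $R_1=AABB$, $R_2=ABBA$, $R_3=ABAB$. (i) For each $j\in\{2,3\}$, the pair $(Q,R_j)$ has exactly one child, and the same holds for the pair $(Q,R_1)$ provided $t(Q)=1$. Moreover, this unique child is collectable and has maturity $0$. (ii) If $t(Q)\ge2$, then the pair $(Q,R_1)$ has exactly $t(Q)$ children, exactly one of which is collectable; moreover, the maturity of this collectable child equals $t(Q)-1=m(Q)+1$.
   Context: An $r$-pattern is an ordered $r$-matching with two edges, considered up to order-isomorphism, written as a word of length $2r$ in letters $A,B$ each occurring $r$ times (swapping the letters gives the same pattern; e.g. $BBAA$ is the same pattern as $AABB$). For an $r$-pattern $P$, $r\ge3$, let $Q(P)$ be the $(r-1)$-pattern obtained from $P$ by deleting the last $A$ and the last $B$, and $R(P)$ the $2$-pattern formed by the last two $A$'s and last two $B$'s of $P$; write $\mathrm{dec}(P)=(Q(P),R(P))$. An $r$-pattern $P$ is a child of the pair $(Q,R)$ if $\mathrm{dec}(P)=(Q,R)$. A $P$-clique is a matching in which every pair of edges is order-isomorphic to $P$; $P$ is collectable if $P$-cliques of every size $k\ge2$ exist. $t(Q)$ denotes the length of the last maximal run of equal letters in the word of $Q$. The maturity $m(P)$ of a collectable pattern is the length of its last maximal run minus $2$, or $0$ if negative. -}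

module Defs where

open import Data.Bool using (Bool; true; false; not; _∧_; if_then_else_)
open import Data.Nat using (ℕ; zero; suc; _+_; _*_; _∸_; _<_; _<ᵇ_; _≡ᵇ_)
open import Data.List using (List; []; _∷_; length; map; reverse; filterᵇ; _++_)
open import Data.List.Relation.Unary.AllPairs using (AllPairs)
open import Data.List.Membership.Propositional using (_∈_)
open import Data.Fin using (Fin)
open import Data.Product using (Σ; _×_; ∃)
open import Data.Empty using (⊥)
open import Relation.Binary.PropositionalEquality using (_≡_; _≢_)

pattern A = true
pattern B = false

Word : Set
Word = List Bool

countA : Word → ℕ
countA []      = 0
countA (A ∷ w) = suc (countA w)
countA (B ∷ w) = countA w

-- Patterns are taken up to swapping the letters A and B.  We represent
-- each pattern by its canonical word, the one starting with A.
normalize : Word → Word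
normalize []      = []
normalize (A ∷ w) = A ∷ w
normalize (B ∷ w) = map not (B ∷ w)

startsWithA : Word → Bool
startsWithA (A ∷ _) = true
startsWithA _       = false

isPatternᵇ : ℕ → Word → Bool
isPatternᵇ r w = (length w ≡ᵇ (2 * r)) ∧ (countA w ≡ᵇ r) ∧ startsWithA w

IsPattern : ℕ → Word → Set
IsPattern r w = isPatternᵇ r w ≡ true

_==ᵂ_ : Word → Word → Bool
[]      ==ᵂ []      = true
(a ∷ v) ==ᵂ (b ∷ w) = eqL a b ∧ (v ==ᵂ w)
  where
  eqL : Bool → Bool → Bool
  eqL true  true  = true
  eqL false false = true
  eqL _     _     = false
_       ==ᵂ _       = false

deleteFirst : Bool → Word → Word
deleteFirst c []      = []
deleteFirst A (A ∷ w) = w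
deleteFirst B (B ∷ w) = w
deleteFirst A (B ∷ w) = B ∷ deleteFirst A w
deleteFirst B (A ∷ w) = A ∷ deleteFirst B w

deleteLast : Bool → Word → Word
deleteLast c w = reverse (deleteFirst c (reverse w))

Qof : Word → Word
Qof w = normalize (deleteLast B (deleteLast A w))

keepFirst2 : ℕ → ℕ → Word → Word
keepFirst2 a b [] = []
keepFirst2 a b (A ∷ w) = if a <ᵇ 2 then A ∷ keepFirst2 (suc a) b w else keepFirst2 a b w
keepFirst2 a b (B ∷ w) = if b <ᵇ 2 then B ∷ keepFirst2 a (suc b) w else keepFirst2 a b w

Rof : Word → Word
Rof w = normalize (reverse (keepFirst2 0 0 (reverse w)))

-- Children of a pair (Q,R): the canonical r-patterns P with dec(P) = (Q,R),
-- listed (without repetition) among all words of length 2r.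

allWords : ℕ → List Word
allWords zero    = [] ∷ []
allWords (suc n) = map (A ∷_) (allWords n) ++ map (B ∷_) (allWords n)

isChildᵇ : ℕ → Word → Word → Word → Bool
isChildᵇ r Q R P = isPatternᵇ r P ∧ (Qof P ==ᵂ Q) ∧ (Rof P ==ᵂ R)

children : ℕ → Word → Word → List Word
children r Q R = filterᵇ (isChildᵇ r Q R) (allWords (2 * r))

Edge : ℕ → List ℕ → Set
Edge r e = (length e ≡ r) × AllPairs _<_ e

-- the word of two (sorted, disjoint) edges e (letter A) and f (letter B):
-- read the vertices of e ∪ f in increasing order.
pairWord : List ℕ → List ℕ → Word
pairWord []       f        = map (λ _ → B) f
pairWord (x ∷ xs) []       = map (λ _ → A) (x ∷ xs)
pairWord (x ∷ xs) (y ∷ ys) =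
  if x <ᵇ y then A ∷ pairWord xs (y ∷ ys) else B ∷ pairWord (x ∷ xs) ys

Disjoint : List ℕ → List ℕ → Set
Disjoint e f = ∀ v → v ∈ e → v ∈ f → ⊥

IsClique : ℕ → Word → (k : ℕ) → (Fin k → List ℕ) → Set
IsClique r P k M =
  (∀ i → Edge r (M i)) ×
  (∀ i j → i ≢ j → Disjoint (M i) (M j)) ×
  (∀ i j → i ≢ j → normalize (pairWord (M i) (M j)) ≡ P)

Collectable : ℕ → Word → Set
Collectable r P = ∀ k → 2 Data.Nat.≤ k → ∃ λ (M : Fin k → List ℕ) → IsClique r P k M

-- t(Q): length of the last maximal run; maturity m(P) = max(t(P) - 2, 0).

leadRun : Bool → Word → ℕ
leadRun c []      = 0
leadRun A (A ∷ w) = suc (leadRun A w)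
leadRun B (B ∷ w) = suc (leadRun B w)
leadRun _ _       = 0

lastRun : Word → ℕ
lastRun w with reverse w
... | []      = 0
... | (c ∷ v) = suc (leadRun c v)

maturity : Word → ℕ
maturity P = lastRun P ∸ 2

R₁ R₂ R₃ : Word
R₁ = A ∷ A ∷ B ∷ B ∷ []
R₂ = A ∷ B ∷ B ∷ A ∷ []
R₃ = A ∷ B ∷ A ∷ B ∷ []

module Submission where

-- Write Q = v x̄ x^(t+1), so that t(Q) = t + 1.  Deleting the last A and the last B of a child P must give
-- back Q, which leaves exactly P = Q x x̄ for R₂, P = Q x̄ x for R₃, and P = v x̄ x^m x̄ x^(a+2) with a + m = t
-- for R₁.
-- A clique for the first two, and for the R₁-child with m = 0, is obtained from a Q-clique by giving every
-- edge one more vertex: beyond all vertices, in the order (R₃) or the reverse order (R₂) of the last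
-- vertices of the edges, or right after the last vertex of the edge (R₁).  If m ≥ 1 there is not even a
-- clique of three edges: orienting every pair so that its word ends in A B^m A B^(a+2), comparing the
-- vertices of these tails shows that the orientation can be neither cyclic nor transitive.

open import Defs
open import Data.Bool using (Bool; true; false; not; _∧_; if_then_else_)
open import Data.Bool.Properties using (not-involutive; not-¬; T-≡)
open import Data.Nat using (ℕ; zero; suc; _+_; _*_; _∸_; _⊔_; _≤_; _<_; _<ᵇ_; _≡ᵇ_; z≤n; s≤s)
open import Data.Nat.Properties
open import Data.Fin using (Fin)
open import Data.Fin.Patterns using (0F; 1F; 2F)
import Data.Fin as Fin
open import Data.List using (List; []; _∷_; _∷ʳ_; length; map; reverse; filterᵇ; _++_; replicate; [_]; upTo)
open import Data.List.Properties
open import Data.Product using (_×_; ∃; _,_; proj₁; proj₂)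
open import Data.Sum using (_⊎_; inj₁; inj₂)
open import Data.Empty using (⊥; ⊥-elim)
open import Data.Unit using (⊤; tt)
open import Data.List.Relation.Binary.Permutation.Propositional using (_↭_)
import Data.List.Relation.Binary.Permutation.Propositional as ↭
open import Data.List.Relation.Binary.Permutation.Propositional.Properties using (shift; ↭-reverse; ↭-length)
open import Data.List.Membership.Propositional using (_∈_)
open import Data.List.Membership.Propositional.Properties using (∈-filter⁺; ∈-filter⁻; ∈-map⁺; ∈-map⁻; ∈-++⁺ˡ; ∈-++⁺ʳ; ∈-++⁻; ∈-upTo⁺; ∈-upTo⁻)
open import Data.List.Membership.Propositional.Properties.WithK using (unique∧set⇒bag)
open import Data.List.Relation.Binary.BagAndSetEquality using (∼bag⇒↭)
open import Data.List.Relation.Unary.Any using (here; there)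
open import Data.List.Relation.Unary.All using (All; []; _∷_)
import Data.List.Relation.Unary.All as All
open import Data.List.Relation.Unary.AllPairs using (AllPairs; []; _∷_)
import Data.List.Relation.Unary.AllPairs.Properties as AllPairs
open import Data.List.Relation.Unary.Linked using (Linked; [-]; _∷_)
open import Data.List.Relation.Unary.Linked.Properties using (AllPairs⇒Linked; Linked⇒AllPairs)
open import Data.List.Relation.Unary.Unique.Propositional using (Unique)
import Data.List.Relation.Unary.Unique.Propositional.Properties as Unique
open import Relation.Binary.Definitions using (tri<; tri≈; tri>)
open import Relation.Nullary using (¬_)
open import Relation.Nullary.Decidable using (T?)
open import Relation.Nullary.Reflects using (ofʸ; ofⁿ)
open import Function using (id; _∘_; _⇔_; mk⇔; Equivalence; case_of_)
open import Relation.Binary.PropositionalEquality hiding ([_])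

map-not-involutive : ∀ w → map not (map not w) ≡ w
map-not-involutive []      = refl
map-not-involutive (c ∷ w) = cong₂ _∷_ (not-involutive c) (map-not-involutive w)

map-not-injective : ∀ {v w} → map not v ≡ w → v ≡ map not w
map-not-injective {v} refl = sym (map-not-involutive v)

normalize≡⇒ : ∀ {w P} → normalize w ≡ P → w ≡ P ⊎ w ≡ map not P
normalize≡⇒ {[]}    refl = inj₁ refl
normalize≡⇒ {A ∷ w} refl = inj₁ refl
normalize≡⇒ {B ∷ w} eq   = inj₂ (map-not-injective eq)

normalize-canonical : ∀ {w} → startsWithA w ≡ true → normalize w ≡ w
normalize-canonical {A ∷ w} _ = refl

normalize-map-not : ∀ {w} → startsWithA w ≡ true → normalize (map not w) ≡ w
normalize-map-not {A ∷ w} _ = cong (A ∷_) (map-not-involutive w)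

startsWithA-++ : ∀ {v} w → startsWithA v ≡ true → startsWithA (v ++ w) ≡ true
startsWithA-++ {A ∷ v} w _ = refl

==ᵂ⇒≡ : ∀ v w → (v ==ᵂ w) ≡ true → v ≡ w
==ᵂ⇒≡ []      []      _ = refl
==ᵂ⇒≡ (A ∷ v) (A ∷ w) e = cong (A ∷_) (==ᵂ⇒≡ v w e)
==ᵂ⇒≡ (B ∷ v) (B ∷ w) e = cong (B ∷_) (==ᵂ⇒≡ v w e)

==ᵂ-refl : ∀ w → (w ==ᵂ w) ≡ true
==ᵂ-refl []      = refl
==ᵂ-refl (A ∷ w) = ==ᵂ-refl w
==ᵂ-refl (B ∷ w) = ==ᵂ-refl w

∧≡true⇒ : ∀ {a b} → (a ∧ b) ≡ true → a ≡ true × b ≡ true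
∧≡true⇒ {true} {true} _ = refl , refl

≡ᵇ≡true⇒ : ∀ {m n} → (m ≡ᵇ n) ≡ true → m ≡ n
≡ᵇ≡true⇒ {m} {n} e = ≡ᵇ⇒≡ m n (Equivalence.from T-≡ e)

record PatternFacts (r : ℕ) (w : Word) : Set where
  field
    length≡ : length w ≡ 2 * r
    countA≡ : countA w ≡ r
    startsA : startsWithA w ≡ true

IsPattern⇒ : ∀ {r w} → IsPattern r w → PatternFacts r w
IsPattern⇒ {r} {w} e =
  let l , cs = ∧≡true⇒ {length w ≡ᵇ 2 * r} e
      c , s  = ∧≡true⇒ {countA w ≡ᵇ r} cs
  in record { length≡ = ≡ᵇ≡true⇒ l ; countA≡ = ≡ᵇ≡true⇒ c ; startsA = s }

⇒IsPattern : ∀ {r w} → PatternFacts r w → IsPattern r w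
⇒IsPattern {r} record { length≡ = l ; countA≡ = c ; startsA = s }
  rewrite l | c | s | Equivalence.to T-≡ (≡⇒≡ᵇ (2 * r) (2 * r) refl) | Equivalence.to T-≡ (≡⇒≡ᵇ r r refl) = refl

data Letter (c : Bool) : Bool → Set where
  same  : Letter c c
  other : Letter c (not c)

letter : ∀ c d → Letter c d
letter A A = same
letter A B = other
letter B B = same
letter B A = other

deleteFirst-head : ∀ c w → deleteFirst c (c ∷ w) ≡ w
deleteFirst-head A w = refl
deleteFirst-head B w = refl

deleteFirst-skip : ∀ c w → deleteFirst c (not c ∷ w) ≡ not c ∷ deleteFirst c w
deleteFirst-skip A w = refl
deleteFirst-skip B w = refl

deleteFirst-skip′ : ∀ c w → deleteFirst (not c) (c ∷ w) ≡ c ∷ deleteFirst (not c) w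
deleteFirst-skip′ A w = refl
deleteFirst-skip′ B w = refl

deleteFirst-comm : ∀ w → deleteFirst A (deleteFirst B w) ≡ deleteFirst B (deleteFirst A w)
deleteFirst-comm []      = refl
deleteFirst-comm (A ∷ w) = refl
deleteFirst-comm (B ∷ w) = refl

replicate-+ : ∀ {c : Bool} m n w → replicate m c ++ replicate n c ++ w ≡ replicate (m + n) c ++ w
replicate-+ zero    n w = refl
replicate-+ (suc m) n w = cong (_ ∷_) (replicate-+ m n w)

deleteFirst-replicate : ∀ c n w → deleteFirst (not c) (replicate n c ++ not c ∷ w) ≡ replicate n c ++ w
deleteFirst-replicate c zero    w = deleteFirst-head (not c) w
deleteFirst-replicate c (suc n) w = trans (deleteFirst-skip′ c _) (cong (c ∷_) (deleteFirst-replicate c n w))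

deleteFirst≡∷⇒ : ∀ c p {w} → deleteFirst c p ≡ c ∷ w → p ≡ c ∷ c ∷ w
deleteFirst≡∷⇒ c []      ()
deleteFirst≡∷⇒ c (d ∷ p) e with letter c d
... | same  = cong (c ∷_) (trans (sym (deleteFirst-head c p)) e)
... | other = ⊥-elim (not-¬ refl (sym (∷-injectiveˡ (trans (sym (deleteFirst-skip c p)) e))))

deleteFirst≡⇒ : ∀ c n p u → deleteFirst (not c) p ≡ replicate n c ++ not c ∷ u →
  ∃ λ a → ∃ λ m → a + m ≡ n × p ≡ replicate a c ++ not c ∷ replicate m c ++ not c ∷ u
deleteFirst≡⇒ c zero    [] u ()
deleteFirst≡⇒ c (suc n) [] u ()
deleteFirst≡⇒ c n (d ∷ p) u e with letter c d
... | other = 0 , n , refl , cong (not c ∷_) (trans (sym (deleteFirst-head (not c) p)) e)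
deleteFirst≡⇒ c zero (d ∷ p) u e | same =
  ⊥-elim (not-¬ refl (∷-injectiveˡ (trans (sym (deleteFirst-skip′ c p)) e)))
deleteFirst≡⇒ c (suc n) (d ∷ p) u e | same
  with a , m , a+m≡n , p≡ ← deleteFirst≡⇒ c n p u (∷-injectiveʳ (trans (sym (deleteFirst-skip′ c p)) e)) =
  suc a , m , cong suc a+m≡n , cong (c ∷_) p≡

runForm : Bool → ℕ → Word → Word
runForm c t u = replicate (suc t) c ++ not c ∷ u

shape₂ shape₃ : Bool → ℕ → Word → Word
shape₂ c t u = not c ∷ replicate (2 + t) c ++ not c ∷ u
shape₃ c t u = c ∷ not c ∷ replicate (suc t) c ++ not c ∷ u

shape₁ : Bool → ℕ → ℕ → Word → Word
shape₁ c a m u = replicate (2 + a) c ++ not c ∷ replicate m c ++ not c ∷ u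

-- Children are handled through their reversals, where the last A and B become the first ones: these are the
-- reversals z of the children of (Q, R) when reverse Q = runForm c t u.
data Shape (c : Bool) (t : ℕ) (u : Word) : Word → Word → Set where
  is₂ : Shape c t u R₂ (shape₂ c t u)
  is₃ : Shape c t u R₃ (shape₃ c t u)
  is₁ : ∀ a m → a + m ≡ t → Shape c t u R₁ (shape₁ c a m u)

deleteBoth : Bool → Word → Word
deleteBoth c z = deleteFirst c (deleteFirst (not c) z)

deleteBoth-letter : ∀ c z → deleteBoth c z ≡ deleteFirst B (deleteFirst A z)
deleteBoth-letter A z = deleteFirst-comm z
deleteBoth-letter B z = refl

deleteBoth-Shape : ∀ {c t u R z} → Shape c t u R z → deleteBoth c z ≡ runForm c t u
deleteBoth-Shape {c} is₂ =
  trans (cong (deleteFirst c) (deleteFirst-head (not c) _)) (deleteFirst-head c _)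
deleteBoth-Shape {c} is₃ =
  trans (cong (deleteFirst c) (trans (deleteFirst-skip′ c _) (cong (c ∷_) (deleteFirst-head (not c) _))))
        (deleteFirst-head c _)
deleteBoth-Shape {c} {t} {u} (is₁ a m a+m≡t) = begin
  deleteFirst c (deleteFirst (not c) (replicate (2 + a) c ++ not c ∷ replicate m c ++ not c ∷ u))
    ≡⟨ cong (deleteFirst c) (deleteFirst-replicate c (2 + a) _) ⟩
  deleteFirst c (c ∷ replicate (suc a) c ++ replicate m c ++ not c ∷ u)
    ≡⟨ deleteFirst-head c _ ⟩
  replicate (suc a) c ++ replicate m c ++ not c ∷ u
    ≡⟨ replicate-+ (suc a) m _ ⟩
  replicate (suc a + m) c ++ not c ∷ u
    ≡⟨ cong (λ n → replicate (suc n) c ++ not c ∷ u) a+m≡t ⟩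
  replicate (suc t) c ++ not c ∷ u ∎
  where open ≡-Reasoning

deleteBoth⇒Shape : ∀ c t u z → deleteBoth c z ≡ runForm c t u → ∃ λ R → Shape c t u R z
deleteBoth⇒Shape c t u (d ∷ z) e with letter c d
... | other rewrite deleteFirst≡∷⇒ c z (trans (cong (deleteFirst c) (sym (deleteFirst-head (not c) z))) e) = R₂ , is₂
... | same with deleteFirst≡⇒ c (suc t) z u (trans (sym (deleteFirst-head c _))
                                              (trans (cong (deleteFirst c) (sym (deleteFirst-skip′ c z))) e))
...   | zero  , m , refl , refl = R₃ , is₃
...   | suc a , m , a+m≡t , refl = R₁ , is₁ a m (suc-injective a+m≡t)

Shape-prefix : ∀ {c t u R z} → Shape c t u R z → ∃ λ s → z ≡ s ++ not c ∷ u
Shape-prefix {c} {t} is₂          = not c ∷ replicate (2 + t) c , refl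
Shape-prefix {c} {t} is₃          = c ∷ not c ∷ replicate (suc t) c , refl
Shape-prefix {c} {u = u} (is₁ a m _) =
  replicate (2 + a) c ++ not c ∷ replicate m c , sym (++-assoc (replicate (2 + a) c) (not c ∷ replicate m c) (not c ∷ u))

Shape-↭ : ∀ {c t u R z} → Shape c t u R z → z ↭ c ∷ not c ∷ runForm c t u
Shape-↭ {c} is₂ = ↭.swap (not c) c ↭.refl
Shape-↭     is₃ = ↭.refl
Shape-↭ {c} {u = u} (is₁ a m a+m≡t) =
  subst (λ w → shape₁ c a m u ↭ c ∷ not c ∷ w) runs (↭.prep c (shift (not c) (replicate (suc a) c) _))
  where
  runs : replicate (suc a) c ++ replicate m c ++ not c ∷ u ≡ runForm c _ u
  runs = trans (replicate-+ (suc a) m _) (cong (λ n → replicate (suc n) c ++ not c ∷ u) a+m≡t)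

reverse-++-∷ : ∀ s (d : Bool) u → reverse (s ++ d ∷ u) ≡ reverse u ++ d ∷ reverse s
reverse-++-∷ s d u = begin
  reverse (s ++ d ∷ u)          ≡⟨ reverse-++ s (d ∷ u) ⟩
  reverse (d ∷ u) ++ reverse s  ≡⟨ cong (_++ reverse s) (unfold-reverse d u) ⟩
  (reverse u ∷ʳ d) ++ reverse s ≡⟨ ++-assoc (reverse u) [ d ] (reverse s) ⟩
  reverse u ++ d ∷ reverse s    ∎
  where open ≡-Reasoning

reverse-replicate : ∀ n (c : Bool) → reverse (replicate n c) ≡ replicate n c
reverse-replicate zero    c = refl
reverse-replicate (suc n) c = begin
  reverse (c ∷ replicate n c) ≡⟨ unfold-reverse c (replicate n c) ⟩
  reverse (replicate n c) ∷ʳ c ≡⟨ cong (_∷ʳ c) (reverse-replicate n c) ⟩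
  replicate n c ∷ʳ c           ≡⟨ replicate-+ n 1 [] ⟩
  replicate (n + 1) c ++ []    ≡⟨ cong (λ k → replicate k c ++ []) (+-comm n 1) ⟩
  c ∷ replicate n c ++ []      ≡⟨ ++-identityʳ _ ⟩
  c ∷ replicate n c            ∎
  where open ≡-Reasoning

reverse-runForm : ∀ c t u → reverse (runForm c t u) ≡ reverse u ++ not c ∷ replicate (suc t) c
reverse-runForm c t u = trans (reverse-++-∷ (replicate (suc t) c) (not c) u)
                              (cong (λ w → reverse u ++ not c ∷ w) (reverse-replicate (suc t) c))

reverse-shape₁ : ∀ c a m u → reverse (shape₁ c a m u) ≡ reverse u ++ not c ∷ replicate m c ++ not c ∷ replicate (2 + a) c
reverse-shape₁ c a m u = begin
  reverse (replicate (2 + a) c ++ not c ∷ replicate m c ++ not c ∷ u)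
    ≡⟨ reverse-++-∷ (replicate (2 + a) c) (not c) _ ⟩
  reverse (replicate m c ++ not c ∷ u) ++ not c ∷ reverse (replicate (2 + a) c)
    ≡⟨ cong₂ (λ v w → v ++ not c ∷ w) (reverse-++-∷ (replicate m c) (not c) u) (reverse-replicate (2 + a) c) ⟩
  (reverse u ++ not c ∷ reverse (replicate m c)) ++ not c ∷ replicate (2 + a) c
    ≡⟨ cong (λ w → (reverse u ++ not c ∷ w) ++ not c ∷ replicate (2 + a) c) (reverse-replicate m c) ⟩
  (reverse u ++ not c ∷ replicate m c) ++ not c ∷ replicate (2 + a) c
    ≡⟨ ++-assoc (reverse u) (not c ∷ replicate m c) _ ⟩
  reverse u ++ not c ∷ replicate m c ++ not c ∷ replicate (2 + a) c ∎
  where open ≡-Reasoning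

reverse≡⇒ : ∀ {v w : Word} → reverse v ≡ w → v ≡ reverse w
reverse≡⇒ {v} refl = sym (reverse-involutive v)

map-not-runForm : ∀ c t u → map not (runForm c t u) ≡ runForm (not c) t (map not u)
map-not-runForm c t u = trans (map-++ not (replicate (suc t) c) (not c ∷ u))
                              (cong (_++ not (not c) ∷ map not u) (map-replicate not (suc t) c))

countA-↭ : ∀ {v w} → v ↭ w → countA v ≡ countA w
countA-↭ ↭.refl           = refl
countA-↭ (↭.prep A p)     = cong suc (countA-↭ p)
countA-↭ (↭.prep B p)     = countA-↭ p
countA-↭ (↭.swap A A p)   = cong (suc ∘ suc) (countA-↭ p)
countA-↭ (↭.swap A B p)   = cong suc (countA-↭ p)
countA-↭ (↭.swap B A p)   = cong suc (countA-↭ p)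
countA-↭ (↭.swap B B p)   = countA-↭ p
countA-↭ (↭.trans p q)    = trans (countA-↭ p) (countA-↭ q)

countA-pair : ∀ c w → countA (c ∷ not c ∷ w) ≡ suc (countA w)
countA-pair A w = refl
countA-pair B w = refl

keepFirst2-skipA : ∀ b n w → keepFirst2 2 b (replicate n A ++ w) ≡ keepFirst2 2 b w
keepFirst2-skipA b zero    w = refl
keepFirst2-skipA b (suc n) w = keepFirst2-skipA b n w

keepFirst2-skipB : ∀ a n w → keepFirst2 a 2 (replicate n B ++ w) ≡ keepFirst2 a 2 w
keepFirst2-skipB a zero    w = refl
keepFirst2-skipB a (suc n) w = keepFirst2-skipB a n w

keepFirst2-done : ∀ w → keepFirst2 2 2 w ≡ []
keepFirst2-done []      = refl
keepFirst2-done (A ∷ w) = keepFirst2-done w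
keepFirst2-done (B ∷ w) = keepFirst2-done w

Shape-Rof : ∀ {c t u R z} → Shape c t u R z → normalize (reverse (keepFirst2 0 0 z)) ≡ R
Shape-Rof {A} {t} {u} is₂ rewrite keepFirst2-skipA 1 t (B ∷ u) | keepFirst2-done u = refl
Shape-Rof {B} {t} {u} is₂ rewrite keepFirst2-skipB 1 t (A ∷ u) | keepFirst2-done u = refl
Shape-Rof {A} {t} {u} is₃ rewrite keepFirst2-skipA 1 t (B ∷ u) | keepFirst2-done u = refl
Shape-Rof {B} {t} {u} is₃ rewrite keepFirst2-skipB 1 t (A ∷ u) | keepFirst2-done u = refl
Shape-Rof {A} {u = u} (is₁ a m _)
  rewrite keepFirst2-skipA 0 a (B ∷ replicate m A ++ B ∷ u) | keepFirst2-skipA 1 m (B ∷ u) | keepFirst2-done u = refl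
Shape-Rof {B} {u = u} (is₁ a m _)
  rewrite keepFirst2-skipB 0 a (A ∷ replicate m B ++ A ∷ u) | keepFirst2-skipB 1 m (A ∷ u) | keepFirst2-done u = refl

firstRun : Word → ℕ
firstRun []      = 0
firstRun (c ∷ w) = suc (leadRun c w)

lastRun≡firstRun-reverse : ∀ w → lastRun w ≡ firstRun (reverse w)
lastRun≡firstRun-reverse w with reverse w
... | []    = refl
... | c ∷ v = refl

lastRun-reverse : ∀ z → lastRun (reverse z) ≡ firstRun z
lastRun-reverse z = trans (lastRun≡firstRun-reverse (reverse z)) (cong firstRun (reverse-involutive z))

leadRun-replicate : ∀ c n w → leadRun c (replicate n c ++ not c ∷ w) ≡ n
leadRun-replicate A zero    w = refl
leadRun-replicate A (suc n) w = cong suc (leadRun-replicate A n w)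
leadRun-replicate B zero    w = refl
leadRun-replicate B (suc n) w = cong suc (leadRun-replicate B n w)

firstRun-shape₂ : ∀ c t u → firstRun (shape₂ c t u) ≡ 1
firstRun-shape₂ A t u = refl
firstRun-shape₂ B t u = refl

firstRun-shape₃ : ∀ c t u → firstRun (shape₃ c t u) ≡ 1
firstRun-shape₃ c t u = cong suc (leadRun-replicate c 0 _)

firstRun-shape₁ : ∀ c a m u → firstRun (shape₁ c a m u) ≡ 2 + a
firstRun-shape₁ c a m u = cong suc (leadRun-replicate c (suc a) _)

record LastRunSplit (Q : Word) : Set where
  field
    lastLetter   : Bool
    t            : ℕ
    rest         : Word
    reverse≡     : reverse Q ≡ runForm lastLetter t rest
    rest-startsA : startsWithA (reverse rest) ≡ true

  lastRun≡ : lastRun Q ≡ suc t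
  lastRun≡ = trans (lastRun≡firstRun-reverse Q)
                   (trans (cong firstRun reverse≡) (cong suc (leadRun-replicate lastLetter t rest)))

splitLeadRun : ∀ c w → w ≡ replicate (leadRun c w) c ⊎ ∃ λ u → w ≡ replicate (leadRun c w) c ++ not c ∷ u
splitLeadRun c [] = inj₁ refl
splitLeadRun A (B ∷ w) = inj₂ (w , refl)
splitLeadRun B (A ∷ w) = inj₂ (w , refl)
splitLeadRun A (A ∷ w) with splitLeadRun A w
... | inj₁ e       = inj₁ (cong (A ∷_) e)
... | inj₂ (u , e) = inj₂ (u , cong (A ∷_) e)
splitLeadRun B (B ∷ w) with splitLeadRun B w
... | inj₁ e       = inj₁ (cong (B ∷_) e)
... | inj₂ (u , e) = inj₂ (u , cong (B ∷_) e)

countA-++ : ∀ v w → countA (v ++ w) ≡ countA v + countA w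
countA-++ []      w = refl
countA-++ (A ∷ v) w = cong suc (countA-++ v w)
countA-++ (B ∷ v) w = countA-++ v w

countA-replicateA : ∀ n → countA (replicate n A) ≡ n
countA-replicateA zero    = refl
countA-replicateA (suc n) = cong suc (countA-replicateA n)

countA-replicateB : ∀ n → countA (replicate n B) ≡ 0
countA-replicateB zero    = refl
countA-replicateB (suc n) = countA-replicateB n

startsWithA-++⁻ : ∀ v w → v ≢ [] → startsWithA (v ++ w) ≡ true → startsWithA v ≡ true
startsWithA-++⁻ []      w v≢[] _ = ⊥-elim (v≢[] refl)
startsWithA-++⁻ (A ∷ v) w _    _ = refl

module _ {r Q} (2≤r : 2 ≤ r) (Q-pat : PatternFacts r Q) where
  open PatternFacts Q-pat

  private
    countA-reverse : countA (reverse Q) ≡ r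
    countA-reverse = trans (countA-↭ (↭-reverse Q)) countA≡

    length-reverse≡ : length (reverse Q) ≡ r + r
    length-reverse≡ = trans (length-reverse Q) (trans length≡ (cong (r +_) (+-identityʳ r)))

    reverse≢replicate : ∀ n c → reverse Q ≢ replicate n c
    reverse≢replicate n A e = <⇒≢ (m<m+n r (≤-trans (s≤s z≤n) 2≤r)) (begin
      r                          ≡⟨ sym countA-reverse ⟩
      countA (reverse Q)         ≡⟨ cong countA e ⟩
      countA (replicate n A)     ≡⟨ countA-replicateA n ⟩
      n                          ≡⟨ sym (length-replicate n) ⟩
      length (replicate n A)     ≡⟨ cong length (sym e) ⟩
      length (reverse Q)         ≡⟨ length-reverse≡ ⟩
      r + r                      ∎)
      where open ≡-Reasoning
    reverse≢replicate n B e =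
      <⇒≢ (≤-trans (s≤s z≤n) 2≤r) (sym (trans (sym countA-reverse) (trans (cong countA e) (countA-replicateB n))))

    Q≡ : ∀ c n u → reverse Q ≡ runForm c n u → Q ≡ reverse u ++ not c ∷ replicate (suc n) c
    Q≡ c n u e = trans (reverse≡⇒ e) (reverse-runForm c n u)

    rest-startsA : ∀ c n u → reverse Q ≡ runForm c n u → startsWithA (reverse u) ≡ true
    rest-startsA c n (h ∷ u′) e =
      startsWithA-++⁻ (reverse (h ∷ u′)) _ (λ rev≡[] → case reverse≡⇒ {h ∷ u′} rev≡[] of λ ())
        (subst (λ w → startsWithA w ≡ true) (Q≡ c n (h ∷ u′) e) startsA)
    rest-startsA A n [] e with () ← subst (λ w → startsWithA w ≡ true) (Q≡ A n [] e) startsA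
    rest-startsA B n [] e = ⊥-elim (<⇒≢ 2≤r (sym (begin
      r                                       ≡⟨ sym countA-reverse ⟩
      countA (reverse Q)                      ≡⟨ cong countA e ⟩
      countA (replicate (suc n) B ++ A ∷ [])  ≡⟨ countA-++ (replicate (suc n) B) _ ⟩
      countA (replicate (suc n) B) + 1        ≡⟨ cong (_+ 1) (countA-replicateB (suc n)) ⟩
      1                                       ∎)))
      where open ≡-Reasoning

  lastRunSplit : LastRunSplit Q
  lastRunSplit with reverse Q in eq
  ... | [] = ⊥-elim (<⇒≢ (≤-trans (s≤s z≤n) (≤-trans 2≤r (m≤m+n r r))) (trans (cong length (sym eq)) length-reverse≡))
  ... | y ∷ w with splitLeadRun y w
  ...   | inj₁ e = ⊥-elim (reverse≢replicate (suc (leadRun y w)) y (trans eq (cong (y ∷_) e)))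
  ...   | inj₂ (u , e) = record
    { lastLetter = y ; t = leadRun y w ; rest = u ; reverse≡ = rev≡
    ; rest-startsA = rest-startsA y (leadRun y w) u rev≡ }
    where rev≡ = trans eq (cong (y ∷_) e)

Qof≡ : ∀ c P → Qof P ≡ normalize (reverse (deleteBoth c (reverse P)))
Qof≡ c P = cong (normalize ∘ reverse)
  (trans (cong (deleteFirst B) (reverse-involutive (deleteFirst A (reverse P)))) (sym (deleteBoth-letter c (reverse P))))

startsWithA-map-not : ∀ {v} w → startsWithA v ≡ true → startsWithA (map not v ++ w) ≡ false
startsWithA-map-not {A ∷ v} w _ = refl

isChildᵇ⇒ : ∀ {r Q R P} → isChildᵇ r Q R P ≡ true → IsPattern r P × Qof P ≡ Q × Rof P ≡ R
isChildᵇ⇒ {r} {Q} {R} {P} e =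
  let p , qr = ∧≡true⇒ {isPatternᵇ r P} e
      q , rr = ∧≡true⇒ {Qof P ==ᵂ Q} qr
  in p , ==ᵂ⇒≡ _ _ q , ==ᵂ⇒≡ _ _ rr

unique-length : ∀ {xs ys : List Word} → Unique xs → Unique ys → (∀ {z} → z ∈ xs ⇔ z ∈ ys) →
                length xs ≡ length ys
unique-length xs! ys! xs⇔ys = ↭-length (∼bag⇒↭ (unique∧set⇒bag xs! ys! xs⇔ys))

unique-singleton : ∀ {xs : List Word} {x} → Unique xs → (∀ {z} → z ∈ xs ⇔ z ≡ x) → xs ≡ x ∷ []
unique-singleton {xs} {x} xs! xs⇔x =
  length≡1 xs (unique-length xs! ([] ∷ []) (mk⇔ (here ∘ to xs⇔x) λ { (here refl) → from xs⇔x refl }))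
           (to xs⇔x)
  where
  open Equivalence
  length≡1 : ∀ ys → length ys ≡ 1 → (∀ {z} → z ∈ ys → z ≡ x) → ys ≡ x ∷ []
  length≡1 (y ∷ []) _ ∈⇒≡x = cong (_∷ []) (∈⇒≡x (here refl))

∈-allWords : ∀ w → w ∈ allWords (length w)
∈-allWords []      = here refl
∈-allWords (A ∷ w) = ∈-++⁺ˡ (∈-map⁺ (A ∷_) (∈-allWords w))
∈-allWords (B ∷ w) = ∈-++⁺ʳ (map (A ∷_) (allWords (length w))) (∈-map⁺ (B ∷_) (∈-allWords w))

allWords-unique : ∀ n → Unique (allWords n)
allWords-unique zero    = [] ∷ []
allWords-unique (suc n) = Unique.++⁺ (Unique.map⁺ ∷-injectiveʳ (allWords-unique n))
                                    (Unique.map⁺ ∷-injectiveʳ (allWords-unique n)) A≢B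
  where
  A≢B : ∀ {v} → v ∈ map (A ∷_) (allWords n) × v ∈ map (B ∷_) (allWords n) → ⊥
  A≢B (v∈A , v∈B) with _ , _ , refl ← ∈-map⁻ (A ∷_) v∈A with _ , _ , () ← ∈-map⁻ (B ∷_) v∈B

∈-filterᵇ⇔ : ∀ (p : Word → Bool) xs {z} → z ∈ filterᵇ p xs ⇔ (z ∈ xs × p z ≡ true)
∈-filterᵇ⇔ p xs = mk⇔
  (λ z∈ → let z∈xs , pz = ∈-filter⁻ (T? ∘ p) {xs = xs} z∈ in z∈xs , Equivalence.to T-≡ pz)
  (λ (z∈xs , pz) → ∈-filter⁺ (T? ∘ p) z∈xs (Equivalence.from T-≡ pz))

module Children {r Q} (Q-pat : PatternFacts r Q) (split : LastRunSplit Q) where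
  open PatternFacts Q-pat
  open LastRunSplit split renaming (lastLetter to c; rest to u)

  private
    deleteBoth-flip : ∀ {P} → reverse (deleteBoth c (reverse P)) ≡ map not Q →
                      deleteBoth (not c) (reverse P) ≡ runForm (not c) t (map not u)
    deleteBoth-flip {P} rev≡notQ = begin
      deleteBoth (not c) (reverse P)     ≡⟨ trans (deleteBoth-letter (not c) (reverse P)) (sym (deleteBoth-letter c (reverse P))) ⟩
      deleteBoth c (reverse P)           ≡⟨ reverse≡⇒ rev≡notQ ⟩
      reverse (map not Q)                ≡⟨ sym (reverse-map not Q) ⟩
      map not (reverse Q)                ≡⟨ cong (map not) reverse≡ ⟩
      map not (runForm c t u)            ≡⟨ map-not-runForm c t u ⟩
      runForm (not c) t (map not u)      ∎
      where open ≡-Reasoning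

  -- Deleting letters from P cannot give the complement of Q, since P would then begin with B.
  wrongOrientation : ∀ {P} → startsWithA P ≡ true → reverse (deleteBoth c (reverse P)) ≡ map not Q → ⊥
  wrongOrientation {P} P-startsA rev≡notQ
    with _ , shape ← deleteBoth⇒Shape (not c) t (map not u) (reverse P) (deleteBoth-flip {P} rev≡notQ)
    with s , revP≡ ← Shape-prefix shape = case true≡false of λ ()
    where
    open ≡-Reasoning
    true≡false : true ≡ false
    true≡false = begin
      true                                                    ≡⟨ sym P-startsA ⟩
      startsWithA P                                           ≡⟨ cong startsWithA (reverse≡⇒ revP≡) ⟩
      startsWithA (reverse (s ++ not (not c) ∷ map not u))    ≡⟨ cong startsWithA (reverse-++-∷ s _ (map not u)) ⟩
      startsWithA (reverse (map not u) ++ not (not c) ∷ reverse s)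
        ≡⟨ cong (λ v → startsWithA (v ++ not (not c) ∷ reverse s)) (sym (reverse-map not u)) ⟩
      startsWithA (map not (reverse u) ++ not (not c) ∷ reverse s) ≡⟨ startsWithA-map-not _ rest-startsA ⟩
      false                                                   ∎

  isChild⇒Shape : ∀ {R P} → isChildᵇ (suc r) Q R P ≡ true → Shape c t u R (reverse P)
  isChild⇒Shape {R} {P} e with P-pat , Qof≡Q , Rof≡R ← isChildᵇ⇒ {suc r} {Q} {R} {P} e
    with normalize≡⇒ (trans (sym (Qof≡ c P)) Qof≡Q)
  ... | inj₂ rev≡notQ = ⊥-elim (wrongOrientation {P} (PatternFacts.startsA (IsPattern⇒ {suc r} {P} P-pat)) rev≡notQ)
  ... | inj₁ rev≡Q with R′ , shape ← deleteBoth⇒Shape c t u (reverse P) (trans (reverse≡⇒ rev≡Q) reverse≡) =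
    subst (λ R → Shape c t u R (reverse P)) (trans (sym (Shape-Rof shape)) Rof≡R) shape

  Shape⇒isChild : ∀ {R z} → Shape c t u R z → isChildᵇ (suc r) Q R (reverse z) ≡ true
  Shape⇒isChild {R} {z} shape =
    cong₂ _∧_ (⇒IsPattern child-pattern)
      (cong₂ _∧_ (trans (cong (_==ᵂ Q) Qof≡Q) (==ᵂ-refl Q)) (trans (cong (_==ᵂ R) Rof≡R) (==ᵂ-refl R)))
    where
    open ≡-Reasoning
    z↭ = Shape-↭ shape
    child-pattern : PatternFacts (suc r) (reverse z)
    child-pattern = record
      { length≡ = begin
          length (reverse z)                 ≡⟨ trans (length-reverse z) (↭-length z↭) ⟩
          2 + length (runForm c t u)         ≡⟨ cong (λ w → 2 + length w) (sym reverse≡) ⟩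
          2 + length (reverse Q)             ≡⟨ cong (2 +_) (trans (length-reverse Q) length≡) ⟩
          2 + 2 * r                          ≡⟨ sym (*-suc 2 r) ⟩
          2 * suc r                          ∎
      ; countA≡ = begin
          countA (reverse z)                 ≡⟨ trans (countA-↭ (↭-reverse z)) (countA-↭ z↭) ⟩
          countA (c ∷ not c ∷ runForm c t u) ≡⟨ countA-pair c _ ⟩
          suc (countA (runForm c t u))       ≡⟨ cong (suc ∘ countA) (sym reverse≡) ⟩
          suc (countA (reverse Q))           ≡⟨ cong suc (trans (countA-↭ (↭-reverse Q)) countA≡) ⟩
          suc r                              ∎
      ; startsA = let s , z≡ = Shape-prefix shape in
          trans (cong startsWithA (trans (cong reverse z≡) (reverse-++-∷ s (not c) u)))
                (startsWithA-++ _ rest-startsA) }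
    Qof≡Q : Qof (reverse z) ≡ Q
    Qof≡Q = begin
      Qof (reverse z)                                    ≡⟨ Qof≡ c (reverse z) ⟩
      normalize (reverse (deleteBoth c (reverse (reverse z)))) ≡⟨ cong (normalize ∘ reverse ∘ deleteBoth c) (reverse-involutive z) ⟩
      normalize (reverse (deleteBoth c z))               ≡⟨ cong (normalize ∘ reverse) (trans (deleteBoth-Shape shape) (sym reverse≡)) ⟩
      normalize (reverse (reverse Q))                    ≡⟨ cong normalize (reverse-involutive Q) ⟩
      normalize Q                                        ≡⟨ normalize-canonical startsA ⟩
      Q                                                  ∎
    Rof≡R : Rof (reverse z) ≡ R
    Rof≡R = trans (cong (normalize ∘ reverse ∘ keepFirst2 0 0) (reverse-involutive z)) (Shape-Rof shape)

  children-unique : ∀ R → Unique (children (suc r) Q R)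
  children-unique R = Unique.filter⁺ (T? ∘ isChildᵇ (suc r) Q R) (allWords-unique (2 * suc r))

  ∈-children⇒Shape : ∀ {R P} → P ∈ children (suc r) Q R → Shape c t u R (reverse P)
  ∈-children⇒Shape {R} {P} P∈ =
    isChild⇒Shape {R} {P} (proj₂ (Equivalence.to (∈-filterᵇ⇔ (isChildᵇ (suc r) Q R) (allWords (2 * suc r))) P∈))

  Shape⇒∈-children : ∀ {R z} → Shape c t u R z → reverse z ∈ children (suc r) Q R
  Shape⇒∈-children {R} {z} shape =
    Equivalence.from (∈-filterᵇ⇔ (isChildᵇ (suc r) Q R) (allWords (2 * suc r))) (∈-words , isChild)
    where
    isChild = Shape⇒isChild shape
    ∈-words : reverse z ∈ allWords (2 * suc r)
    ∈-words = subst (λ n → reverse z ∈ allWords n)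
                (PatternFacts.length≡ (IsPattern⇒ {suc r} {reverse z} (proj₁ (isChildᵇ⇒ {suc r} {Q} {R} {reverse z} isChild))))
                (∈-allWords (reverse z))

  children≡[_] : ∀ {R z} → Shape c t u R z → (∀ {z′} → Shape c t u R z′ → z′ ≡ z) →
                 children (suc r) Q R ≡ reverse z ∷ []
  children≡[ shape ] only = unique-singleton (children-unique _) (mk⇔
    (λ P∈ → reverse≡⇒ (only (∈-children⇒Shape P∈)))
    (λ { refl → Shape⇒∈-children shape }))

  child₁ : ℕ → Word
  child₁ a = reverse (shape₁ c a (t ∸ a) u)

  Shape-R₁ : ∀ {z} → Shape c t u R₁ z → ∃ λ a → ∃ λ m → a + m ≡ t × z ≡ shape₁ c a m u
  Shape-R₁ (is₁ a m a+m≡t) = a , m , a+m≡t , refl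

  length-children-R₁ : length (children (suc r) Q R₁) ≡ suc t
  length-children-R₁ = begin
    length (children (suc r) Q R₁)    ≡⟨ unique-length (children-unique R₁) child₁-unique (mk⇔ to from) ⟩
    length (map child₁ (upTo (suc t))) ≡⟨ trans (length-map child₁ (upTo (suc t))) (length-upTo (suc t)) ⟩
    suc t                              ∎
    where
    open ≡-Reasoning
    child₁-injective : ∀ {a b} → child₁ a ≡ child₁ b → a ≡ b
    child₁-injective {a} {b} e = suc-injective (suc-injective (begin
      2 + a               ≡⟨ sym (trans (lastRun-reverse _) (firstRun-shape₁ c a (t ∸ a) u)) ⟩
      lastRun (child₁ a)  ≡⟨ cong lastRun e ⟩
      lastRun (child₁ b)  ≡⟨ trans (lastRun-reverse _) (firstRun-shape₁ c b (t ∸ b) u) ⟩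
      2 + b               ∎))
    child₁-unique : Unique (map child₁ (upTo (suc t)))
    child₁-unique = Unique.map⁺ child₁-injective (Unique.upTo⁺ (suc t))
    to : ∀ {P} → P ∈ children (suc r) Q R₁ → P ∈ map child₁ (upTo (suc t))
    to P∈ with a , m , refl , revP≡ ← Shape-R₁ (∈-children⇒Shape P∈) =
      subst (_∈ map child₁ (upTo (suc t)))
            (sym (trans (reverse≡⇒ revP≡) (cong (λ n → reverse (shape₁ c a n u)) (sym (m+n∸m≡n a m)))))
            (∈-map⁺ child₁ (∈-upTo⁺ (s≤s (m≤m+n a m))))
    from : ∀ {P} → P ∈ map child₁ (upTo (suc t)) → P ∈ children (suc r) Q R₁
    from P∈ with a , a∈ , refl ← ∈-map⁻ child₁ P∈ =
      Shape⇒∈-children (is₁ a (t ∸ a) (m+[n∸m]≡n (≤-pred (∈-upTo⁻ a∈))))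

constWord : Bool → List ℕ → Word
constWord c = map (λ _ → c)

pairWord-[]ʳ : ∀ e → pairWord e [] ≡ constWord A e
pairWord-[]ʳ []      = refl
pairWord-[]ʳ (x ∷ e) = refl

pairWord-A∷ : ∀ {x y} xs ys → x < y → pairWord (x ∷ xs) (y ∷ ys) ≡ A ∷ pairWord xs (y ∷ ys)
pairWord-A∷ {x} {y} xs ys x<y with x <ᵇ y | <ᵇ-reflects-< x y
... | true  | _        = refl
... | false | ofⁿ x≮y = ⊥-elim (x≮y x<y)

pairWord-B∷ : ∀ {x y} xs ys → ¬ x < y → pairWord (x ∷ xs) (y ∷ ys) ≡ B ∷ pairWord (x ∷ xs) ys
pairWord-B∷ {x} {y} xs ys x≮y with x <ᵇ y | <ᵇ-reflects-< x y
... | true  | ofʸ x<y = ⊥-elim (x≮y x<y)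
... | false | _       = refl

pairWord-A-first : ∀ {x} xs f → All (x <_) f → pairWord (x ∷ xs) f ≡ A ∷ pairWord xs f
pairWord-A-first xs []      _         = cong (A ∷_) (sym (pairWord-[]ʳ xs))
pairWord-A-first xs (y ∷ f) (x<y ∷ _) = pairWord-A∷ xs f x<y

pairWord-B-first : ∀ {y} e ys → All (y <_) e → pairWord e (y ∷ ys) ≡ B ∷ pairWord e ys
pairWord-B-first []      ys _         = refl
pairWord-B-first (x ∷ e) ys (y<x ∷ _) = pairWord-B∷ e ys (<-asym y<x)

All-<-≤-trans : ∀ {x C} {e : List ℕ} → x < C → All (C ≤_) e → All (x <_) e
All-<-≤-trans x<C = All.map (<-≤-trans x<C)

pairWord-++  : ∀ {C e′ f′} e f → All (_< C) e → All (_< C) f → All (C ≤_) e′ → All (C ≤_) f′ →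
               pairWord (e ++ e′) (f ++ f′) ≡ pairWord e f ++ pairWord e′ f′
pairWord-++∷ : ∀ {C e′ f′} x e f → All (_< C) (x ∷ e) → All (_< C) f → All (C ≤_) e′ → All (C ≤_) f′ →
               pairWord (x ∷ e ++ e′) (f ++ f′) ≡ pairWord (x ∷ e) f ++ pairWord e′ f′
pairWord-++ []      []      _ _ _ _ = refl
pairWord-++ {e′ = e′} [] (y ∷ f) _ (y<C ∷ f<C) C≤e′ C≤f′ =
  trans (pairWord-B-first e′ _ (All-<-≤-trans y<C C≤e′)) (cong (B ∷_) (pairWord-++ [] f [] f<C C≤e′ C≤f′))
pairWord-++ (x ∷ e) f = pairWord-++∷ x e f
pairWord-++∷ {f′ = f′} x e [] (x<C ∷ e<C) _ C≤e′ C≤f′ =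
  trans (pairWord-A-first (e ++ _) f′ (All-<-≤-trans x<C C≤f′))
        (cong (A ∷_) (trans (pairWord-++ e [] e<C [] C≤e′ C≤f′) (cong (_++ _) (pairWord-[]ʳ e))))
pairWord-++∷ x e (y ∷ f) xe<C@(_ ∷ e<C) (y<C ∷ f<C) C≤e′ C≤f′ with x <ᵇ y
... | true  = cong (A ∷_) (pairWord-++ e (y ∷ f) e<C (y<C ∷ f<C) C≤e′ C≤f′)
... | false = cong (B ∷_) (pairWord-++∷ x e f xe<C f<C C≤e′ C≤f′)

lastOr : ∀ {X : Set} → X → List X → X
lastOr d []      = d
lastOr d (x ∷ w) = lastOr x w

lastOr-constWord : ∀ {d} c y ys → lastOr d (constWord c (y ∷ ys)) ≡ c
lastOr-constWord c y []       = refl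
lastOr-constWord c y (z ∷ zs) = lastOr-constWord {c} c z zs

lastOr-member : ∀ {X : Set} (x : X) xs → lastOr x xs ∈ x ∷ xs
lastOr-member x []       = here refl
lastOr-member x (y ∷ ys) = there (lastOr-member y ys)

lastOr-∷ʳ : ∀ {X : Set} (d : X) w x → lastOr d (w ∷ʳ x) ≡ x
lastOr-∷ʳ d []      x = refl
lastOr-∷ʳ d (y ∷ w) x = lastOr-∷ʳ y w x

≤-lastOr : ∀ x xs → AllPairs _<_ (x ∷ xs) → x ≤ lastOr x xs
≤-lastOr x []       _                 = ≤-refl
≤-lastOr x (y ∷ ys) ((x<y ∷ _) ∷ y∷ys↑) = ≤-trans (<⇒≤ x<y) (≤-lastOr y ys y∷ys↑)

lastPair : Word → Word
lastPair w = not (lastOr A w) ∷ lastOr A w ∷ []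

pairWord-∷ : ∀ x xs f → ∃ λ c → ∃ λ w → pairWord (x ∷ xs) f ≡ c ∷ w
pairWord-∷ x xs []       = A , constWord A xs , refl
pairWord-∷ x xs (y ∷ ys) with x <ᵇ y
... | true  = A , _ , refl
... | false = B , _ , refl

lastPair-∷ : ∀ c x xs f → lastPair (c ∷ pairWord (x ∷ xs) f) ≡ lastPair (pairWord (x ∷ xs) f)
lastPair-∷ c x xs f with _ , _ , e ← pairWord-∷ x xs f rewrite e = refl

pairWord-lastPair : ∀ x xs y ys → AllPairs _<_ (x ∷ xs) → AllPairs _<_ (y ∷ ys) → Disjoint (x ∷ xs) (y ∷ ys) →
  pairWord [ lastOr x xs ] [ lastOr y ys ] ≡ lastPair (pairWord (x ∷ xs) (y ∷ ys))
pairWord-lastPair x xs y ys x∷xs↑ y∷ys↑ disjoint with <-cmp x y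
pairWord-lastPair x [] y ys _ y∷ys↑ _ | tri< x<y _ _
  rewrite pairWord-A∷ [] ys x<y | lastOr-constWord {A} B y ys
        | pairWord-A∷ {lastOr x []} [] [] (<-≤-trans x<y (≤-lastOr y ys y∷ys↑)) = refl
pairWord-lastPair x (x′ ∷ xs) y ys (_ ∷ x′∷xs↑) y∷ys↑ disjoint | tri< x<y _ _
  rewrite pairWord-A∷ (x′ ∷ xs) ys x<y | lastPair-∷ A x′ xs (y ∷ ys) =
  pairWord-lastPair x′ xs y ys x′∷xs↑ y∷ys↑ (λ v v∈ → disjoint v (there v∈))
... | tri≈ _ x≡y _ = ⊥-elim (disjoint x (here refl) (here x≡y))
pairWord-lastPair x xs y [] x∷xs↑ _ _ | tri> x≮y _ y<x
  rewrite pairWord-B∷ xs [] x≮y | lastOr-constWord {B} A x xs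
        | pairWord-B∷ {lastOr x xs} {y} [] [] (<-asym (<-≤-trans y<x (≤-lastOr x xs x∷xs↑))) = refl
pairWord-lastPair x xs y (y′ ∷ ys) x∷xs↑ (_ ∷ y′∷ys↑) disjoint | tri> x≮y _ _
  rewrite pairWord-B∷ xs (y′ ∷ ys) x≮y | lastPair-∷ B x xs (y′ ∷ ys) =
  pairWord-lastPair x xs y′ ys x∷xs↑ y′∷ys↑ (λ v v∈ v∈′ → disjoint v v∈ (there v∈′))

Bounded : ℕ → ℕ → List ℕ → Set
Bounded r C e = Edge r e × All (_< C) e

record CliqueLift (r : ℕ) (H : Word → Word) : Set where
  field
    lift          : ℕ → List ℕ → List ℕ
    lift-edge     : ∀ {C e} → Bounded r C e → Edge (suc r) (lift C e)
    lift-disjoint : ∀ {C e f} → Bounded r C e → Bounded r C f → Disjoint e f →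
                    Disjoint (lift C e) (lift C f)
    lift-pairWord : ∀ {C e f} → Bounded r C e → Bounded r C f → Disjoint e f →
                    pairWord (lift C e) (lift C f) ≡ H (pairWord e f)

list-bound : ∀ xs → ∃ λ C → All (_< C) xs
list-bound []       = 0 , []
list-bound (x ∷ xs) with C , xs<C ← list-bound xs =
  suc (x ⊔ C) , s≤s (m≤m⊔n x C) ∷ All.map (λ v<C → m<n⇒m<1+n (<-≤-trans v<C (m≤n⊔m x C))) xs<C

matching-bound : ∀ k (M : Fin k → List ℕ) → ∃ λ C → ∀ i → All (_< C) (M i)
matching-bound zero    M = 0 , λ ()
matching-bound (suc k) M with C₀ , M₀<C₀ ← list-bound (M Fin.zero) | C , M<C ← matching-bound k (M ∘ Fin.suc) =
  C₀ ⊔ C , λ { Fin.zero    → All.map (λ v<C₀ → <-≤-trans v<C₀ (m≤m⊔n C₀ C)) M₀<C₀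
             ; (Fin.suc i) → All.map (λ v<C → <-≤-trans v<C (m≤n⊔m C₀ C)) (M<C i) }

Collectable-lift : ∀ {r H P} → CliqueLift r H → H (map not P) ≡ map not (H P) → startsWithA (H P) ≡ true →
                   Collectable r P → Collectable (suc r) (H P)
Collectable-lift {r} {H} {P} L H-not HP-startsA P-collectable k 2≤k
  with M , edge , disjoint , looks-like-P ← P-collectable k 2≤k
  with C , M<C ← matching-bound k M =
  (λ i → lift C (M i)) ,
  (λ i → lift-edge (bounded i)) ,
  (λ i j i≢j → lift-disjoint (bounded i) (bounded j) (disjoint i j i≢j)) ,
  (λ i j i≢j → trans (cong normalize (lift-pairWord (bounded i) (bounded j) (disjoint i j i≢j)))
                     (normalize-H (normalize≡⇒ (looks-like-P i j i≢j))))
  where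
  open CliqueLift L
  bounded : ∀ i → Bounded r C (M i)
  bounded i = edge i , M<C i
  normalize-H : ∀ {w} → w ≡ P ⊎ w ≡ map not P → normalize (H w) ≡ H P
  normalize-H (inj₁ refl) = normalize-canonical HP-startsA
  normalize-H (inj₂ refl) = trans (cong normalize H-not) (normalize-map-not HP-startsA)

lastOr-map-not : ∀ d w → lastOr (not d) (map not w) ≡ not (lastOr d w)
lastOr-map-not d []      = refl
lastOr-map-not d (c ∷ w) = lastOr-map-not c w

module AppendLift (g : ℕ → ℕ → ℕ) (h : Word → Word)
  (g-pairWord  : ∀ C a b → a < C → b < C → a ≢ b → pairWord [ C + g C a ] [ C + g C b ] ≡ h (pairWord [ a ] [ b ]))
  (g-injective : ∀ C a b → a < C → b < C → g C a ≡ g C b → a ≡ b)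
  (h-not       : ∀ w → h (map not w) ≡ map not (h w)) where

  appendLast : Word → Word
  appendLast w = w ++ h (lastPair w)

  appendLast-map-not : ∀ {w} → startsWithA w ≡ true → appendLast (map not w) ≡ map not (appendLast w)
  appendLast-map-not {c ∷ w} _ = begin
    map not (c ∷ w) ++ h (lastPair (map not (c ∷ w)))     ≡⟨ cong (λ d → map not (c ∷ w) ++ h (not d ∷ d ∷ []))
                                                                   (lastOr-map-not c w) ⟩
    map not (c ∷ w) ++ h (map not (lastPair (c ∷ w)))     ≡⟨ cong (map not (c ∷ w) ++_) (h-not (lastPair (c ∷ w))) ⟩
    map not (c ∷ w) ++ map not (h (lastPair (c ∷ w)))     ≡⟨ sym (map-++ not (c ∷ w) _) ⟩
    map not (appendLast (c ∷ w))                          ∎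
    where open ≡-Reasoning

  append : ℕ → List ℕ → List ℕ
  append C e = e ++ [ C + g C (lastOr 0 e) ]

  C≤new : ∀ C e → All (C ≤_) [ C + g C (lastOr 0 e) ]
  C≤new C e = m≤m+n C _ ∷ []

  appendLift : ∀ {r} → 1 ≤ r → CliqueLift r appendLast
  appendLift {r} 1≤r = record { lift = append ; lift-edge = edge ; lift-disjoint = disjoint ; lift-pairWord = word }
    where
    nonempty : ∀ {C e} → Bounded r C e → ∃ λ x → ∃ λ xs → e ≡ x ∷ xs
    nonempty {e = x ∷ xs} _ = x , xs , refl
    nonempty {e = []} ((r≡0 , _) , _) = ⊥-elim (<⇒≢ 1≤r r≡0)

    edge : ∀ {C e} → Bounded r C e → Edge (suc r) (append C e)
    edge {C} {e} ((length≡ , e↑) , e<C) =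
      trans (length-++ e) (trans (+-comm (length e) 1) (cong suc length≡)) ,
      AllPairs.++⁺ e↑ ([] ∷ []) (All.map (λ v<C → <-≤-trans v<C (m≤m+n C _) ∷ []) e<C)

    disjoint : ∀ {C e f} → Bounded r C e → Bounded r C f → Disjoint e f → Disjoint (append C e) (append C f)
    disjoint {C} {e} {f} be bf e#f v v∈ v∈′ with nonempty be | nonempty bf
    ... | x , xs , refl | y , ys , refl with ∈-++⁻ e v∈ | ∈-++⁻ f v∈′
    ... | inj₁ v∈e        | inj₁ v∈f        = e#f v v∈e v∈f
    ... | inj₁ v∈e        | inj₂ (here refl) = <⇒≱ (All.lookup (proj₂ be) v∈e) (m≤m+n C _)
    ... | inj₂ (here refl) | inj₁ v∈f        = <⇒≱ (All.lookup (proj₂ bf) v∈f) (m≤m+n C _)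
    ... | inj₂ (here refl) | inj₂ (here eq)  =
      e#f _ (lastOr-member x xs) (subst (_∈ f) (sym lasts≡) (lastOr-member y ys))
      where
      lasts≡ : lastOr x xs ≡ lastOr y ys
      lasts≡ = g-injective C _ _ (All.lookup (proj₂ be) (lastOr-member x xs)) (All.lookup (proj₂ bf) (lastOr-member y ys))
                 (+-cancelˡ-≡ C _ _ eq)

    word : ∀ {C e f} → Bounded r C e → Bounded r C f → Disjoint e f →
           pairWord (append C e) (append C f) ≡ appendLast (pairWord e f)
    word {C} {e} {f} be bf e#f with nonempty be | nonempty bf
    ... | x , xs , refl | y , ys , refl = begin
      pairWord (append C e) (append C f)
        ≡⟨ pairWord-++ e f (proj₂ be) (proj₂ bf) (C≤new C e) (C≤new C f) ⟩
      pairWord e f ++ pairWord [ C + g C (lastOr x xs) ] [ C + g C (lastOr y ys) ]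
        ≡⟨ cong (pairWord e f ++_) (g-pairWord C _ _ last-e<C last-f<C lasts≢) ⟩
      pairWord e f ++ h (pairWord [ lastOr x xs ] [ lastOr y ys ])
        ≡⟨ cong (λ w → pairWord e f ++ h w) (pairWord-lastPair x xs y ys (proj₂ (proj₁ be)) (proj₂ (proj₁ bf)) e#f) ⟩
      appendLast (pairWord e f) ∎
      where
      open ≡-Reasoning
      last-e<C = All.lookup (proj₂ be) (lastOr-member x xs)
      last-f<C = All.lookup (proj₂ bf) (lastOr-member y ys)
      lasts≢ : lastOr x xs ≢ lastOr y ys
      lasts≢ eq = e#f _ (lastOr-member x xs) (subst (_∈ f) (sym eq) (lastOr-member y ys))

pairWord-shift : ∀ C a b → pairWord [ C + a ] [ C + b ] ≡ pairWord [ a ] [ b ]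
pairWord-shift zero    a b = refl
pairWord-shift (suc C) a b = pairWord-shift C a b

pairWord-mirror : ∀ C a b → a < C → b < C → a ≢ b → pairWord [ C ∸ a ] [ C ∸ b ] ≡ map not (pairWord [ a ] [ b ])
pairWord-mirror C a b a<C b<C a≢b with <-cmp a b
... | tri< a<b _ _ rewrite pairWord-A∷ {a} {b} [] [] a<b =
  pairWord-B∷ [] [] (<-asym (∸-monoʳ-< a<b (<⇒≤ b<C)))
... | tri≈ _ a≡b _ = ⊥-elim (a≢b a≡b)
... | tri> a≮b _ b<a rewrite pairWord-B∷ {a} {b} [] [] a≮b =
  pairWord-A∷ [] [] (∸-monoʳ-< b<a (<⇒≤ a<C))

-- The new vertices lie beyond the bound C in the order (ShiftLift) or the reverse order (MirrorLift) of the
-- old last vertices.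
module ShiftLift = AppendLift (λ C a → a) (λ w → w)
  (λ C a b _ _ _ → pairWord-shift C a b) (λ C a b _ _ → id) (λ w → refl)

module MirrorLift = AppendLift (λ C a → C ∸ a) (map not)
  (λ C a b a<C b<C a≢b → trans (pairWord-shift C (C ∸ a) (C ∸ b)) (pairWord-mirror C a b a<C b<C a≢b))
  (λ C a b a<C b<C eq → trans (sym (m∸[m∸n]≡n (<⇒≤ a<C))) (trans (cong (C ∸_) eq) (m∸[m∸n]≡n (<⇒≤ b<C))))
  (λ w → refl)

twice : ℕ → ℕ
twice zero    = zero
twice (suc n) = suc (suc (twice n))

half : ℕ → ℕ
half zero          = zero
half (suc zero)    = zero
half (suc (suc n)) = suc (half n)

half-twice : ∀ n → half (twice n) ≡ n
half-twice zero    = refl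
half-twice (suc n) = cong suc (half-twice n)

half-suc-twice : ∀ n → half (suc (twice n)) ≡ n
half-suc-twice zero    = refl
half-suc-twice (suc n) = cong suc (half-suc-twice n)

suc-twice-< : ∀ {m n} → m < n → suc (twice m) < twice n
suc-twice-< {zero}  {suc n} _         = s≤s (s≤s z≤n)
suc-twice-< {suc m} {suc n} (s≤s m<n) = s≤s (s≤s (suc-twice-< m<n))

twice-< : ∀ {m n} → m < n → twice m < twice n
twice-< m<n = <-trans (n<1+n _) (suc-twice-< m<n)

doubleTail : ℕ → List ℕ → List ℕ
doubleTail x []       = suc (twice x) ∷ []
doubleTail x (y ∷ ys) = twice y ∷ doubleTail y ys

doubleEdge : List ℕ → List ℕ
doubleEdge []       = []
doubleEdge (x ∷ xs) = twice x ∷ doubleTail x xs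

half-∈-doubleTail : ∀ {v} x xs → v ∈ doubleTail x xs → half v ∈ x ∷ xs
half-∈-doubleTail x []       (here refl)  = here (half-suc-twice x)
half-∈-doubleTail x (y ∷ ys) (here refl)  = there (here (half-twice y))
half-∈-doubleTail x (y ∷ ys) (there v∈)   = there (half-∈-doubleTail y ys v∈)

half-∈-doubleEdge : ∀ {v} e → v ∈ doubleEdge e → half v ∈ e
half-∈-doubleEdge (x ∷ xs) (here refl) = here (half-twice x)
half-∈-doubleEdge (x ∷ xs) (there v∈)  = half-∈-doubleTail x xs v∈

length-doubleTail : ∀ x xs → length (doubleTail x xs) ≡ suc (length xs)
length-doubleTail x []       = refl
length-doubleTail x (y ∷ ys) = cong suc (length-doubleTail y ys)

doubleTail-linked : ∀ x xs → Linked _<_ (x ∷ xs) → Linked _<_ (twice x ∷ doubleTail x xs)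
doubleTail-linked x []       _           = n<1+n _ ∷ [-]
doubleTail-linked x (y ∷ ys) (x<y ∷ y∷ys↑) = twice-< x<y ∷ doubleTail-linked y ys y∷ys↑

contains : Bool → Word → Bool
contains c []      = false
contains A (A ∷ w) = true
contains B (B ∷ w) = true
contains A (B ∷ w) = contains A w
contains B (A ∷ w) = contains B w

doubleLast : Word → Word
doubleLast []      = []
doubleLast (c ∷ w) = c ∷ (if contains c w then doubleLast w else c ∷ doubleLast w)

contains-head : ∀ c w → contains c (c ∷ w) ≡ true
contains-head A w = refl
contains-head B w = refl

contains-constWord : ∀ c f → contains (not c) (constWord c f) ≡ false
contains-constWord c []      = refl
contains-constWord A (y ∷ f) = contains-constWord A f
contains-constWord B (y ∷ f) = contains-constWord B f

contains-A-pairWord : ∀ x xs f → contains A (pairWord (x ∷ xs) f) ≡ true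
contains-A-pairWord x xs []       = refl
contains-A-pairWord x xs (y ∷ ys) with x <ᵇ y
... | true  = refl
... | false = contains-A-pairWord x xs ys

contains-B-pairWord : ∀ e y ys → contains B (pairWord e (y ∷ ys)) ≡ true
contains-B-pairWord []       y ys = refl
contains-B-pairWord (x ∷ xs) y ys with x <ᵇ y
... | true  = contains-B-pairWord xs y ys
... | false = refl

doubleLast-constWord : ∀ c f → doubleLast (constWord c f) ≡ constWord c (doubleEdge f)
doubleLast-constWord c [] = refl
doubleLast-constWord c (y ∷ f) = cong (c ∷_) (tail f)
  where
  tail : ∀ f {y} → (if contains c (constWord c f) then doubleLast (constWord c f) else c ∷ doubleLast (constWord c f))
                   ≡ constWord c (doubleTail y f)
  tail []      = refl
  tail (z ∷ f) rewrite contains-head c (constWord c f) = cong (c ∷_) (tail f)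

contains-map-not : ∀ c w → contains (not c) (map not w) ≡ contains c w
contains-map-not c []      = refl
contains-map-not A (A ∷ w) = refl
contains-map-not A (B ∷ w) = contains-map-not A w
contains-map-not B (A ∷ w) = contains-map-not B w
contains-map-not B (B ∷ w) = refl

doubleLast-map-not : ∀ w → doubleLast (map not w) ≡ map not (doubleLast w)
doubleLast-map-not []      = refl
doubleLast-map-not (c ∷ w) rewrite contains-map-not c w | doubleLast-map-not w with contains c w
... | true  = refl
... | false = refl

doubleLast-∷-seen : ∀ {c w} → contains c w ≡ true → doubleLast (c ∷ w) ≡ c ∷ doubleLast w
doubleLast-∷-seen e rewrite e = refl

doubleLast-∷-last : ∀ {c w} → contains c w ≡ false → doubleLast (c ∷ w) ≡ c ∷ c ∷ doubleLast w
doubleLast-∷-last e rewrite e = refl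

contains-++ : ∀ c v {s} → contains c s ≡ true → contains c (v ++ s) ≡ true
contains-++ c []      s∋c = s∋c
contains-++ A (A ∷ v) s∋c = refl
contains-++ A (B ∷ v) s∋c = contains-++ A v s∋c
contains-++ B (A ∷ v) s∋c = contains-++ B v s∋c
contains-++ B (B ∷ v) s∋c = refl

doubleLast-++ : ∀ v {s} → contains A s ≡ true → contains B s ≡ true → doubleLast (v ++ s) ≡ v ++ doubleLast s
doubleLast-++ []      _   _   = refl
doubleLast-++ (A ∷ v) s∋A s∋B = trans (doubleLast-∷-seen (contains-++ A v s∋A)) (cong (A ∷_) (doubleLast-++ v s∋A s∋B))
doubleLast-++ (B ∷ v) s∋A s∋B = trans (doubleLast-∷-seen (contains-++ B v s∋B)) (cong (B ∷_) (doubleLast-++ v s∋A s∋B))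

contains-pair : ∀ d c w → contains d (not c ∷ c ∷ w) ≡ true
contains-pair A A w = refl
contains-pair A B w = refl
contains-pair B A w = refl
contains-pair B B w = refl

contains-replicate : ∀ c n → contains (not c) (replicate n c) ≡ false
contains-replicate c zero    = refl
contains-replicate A (suc n) = contains-replicate A n
contains-replicate B (suc n) = contains-replicate B n

doubleLast-replicate : ∀ c n → doubleLast (replicate (suc n) c) ≡ replicate (2 + n) c
doubleLast-replicate c zero    = refl
doubleLast-replicate c (suc n) = trans (doubleLast-∷-seen (contains-head c (replicate n c)))
                                       (cong (c ∷_) (doubleLast-replicate c n))

doubleLast-startsA : ∀ {w} → startsWithA w ≡ true → startsWithA (doubleLast w) ≡ true
doubleLast-startsA {A ∷ w} _ = refl

pairWord-doubleEdge  : ∀ e f → Disjoint e f → pairWord (doubleEdge e) (doubleEdge f) ≡ doubleLast (pairWord e f)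
pairWord-doubleEdge∷ : ∀ x xs f → Disjoint (x ∷ xs) f →
                       pairWord (doubleEdge (x ∷ xs)) (doubleEdge f) ≡ doubleLast (pairWord (x ∷ xs) f)
pairWord-doubleEdge []       f = λ _ → sym (doubleLast-constWord B f)
pairWord-doubleEdge (x ∷ xs) f = pairWord-doubleEdge∷ x xs f
pairWord-doubleEdge∷ x xs [] _ = trans (pairWord-[]ʳ (doubleEdge (x ∷ xs))) (sym (doubleLast-constWord A (x ∷ xs)))
pairWord-doubleEdge∷ x xs (y ∷ ys) e#f with <-cmp x y
... | tri≈ _ x≡y _ = ⊥-elim (e#f x (here refl) (here x≡y))
pairWord-doubleEdge∷ x [] f@(y ∷ ys) e#f | tri< x<y _ _ = begin
  pairWord (twice x ∷ suc (twice x) ∷ []) (doubleEdge f)  ≡⟨ pairWord-A∷ (suc (twice x) ∷ []) (doubleTail y ys) (twice-< x<y) ⟩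
  A ∷ pairWord (suc (twice x) ∷ []) (doubleEdge f)        ≡⟨ cong (A ∷_) (pairWord-A∷ [] (doubleTail y ys) (suc-twice-< x<y)) ⟩
  A ∷ A ∷ constWord B (doubleEdge f)                      ≡⟨ cong (λ w → A ∷ A ∷ w) (sym (doubleLast-constWord B f)) ⟩
  A ∷ A ∷ doubleLast (constWord B f)                      ≡⟨ sym (doubleLast-∷-last {A} {constWord B f} (contains-constWord B f)) ⟩
  doubleLast (A ∷ pairWord [] f)                          ≡⟨ cong doubleLast (sym (pairWord-A∷ [] ys x<y)) ⟩
  doubleLast (pairWord (x ∷ []) f)                        ∎
  where open ≡-Reasoning
pairWord-doubleEdge∷ x e@(x′ ∷ xs) f@(y ∷ ys) e#f | tri< x<y _ _ = begin
  pairWord (twice x ∷ doubleEdge e) (doubleEdge f)        ≡⟨ pairWord-A∷ (doubleEdge e) (doubleTail y ys) (twice-< x<y) ⟩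
  A ∷ pairWord (doubleEdge e) (doubleEdge f)              ≡⟨ cong (A ∷_) (pairWord-doubleEdge e f (λ v v∈ → e#f v (there v∈))) ⟩
  A ∷ doubleLast (pairWord e f)                           ≡⟨ sym (doubleLast-∷-seen (contains-A-pairWord x′ xs f)) ⟩
  doubleLast (A ∷ pairWord e f)                           ≡⟨ cong doubleLast (sym (pairWord-A∷ e ys x<y)) ⟩
  doubleLast (pairWord (x ∷ e) f)                         ∎
  where open ≡-Reasoning
pairWord-doubleEdge∷ x xs (y ∷ []) e#f | tri> x≮y _ y<x = begin
  pairWord (doubleEdge e) (twice y ∷ suc (twice y) ∷ [])  ≡⟨ pairWord-B∷ (doubleTail x xs) (suc (twice y) ∷ []) (<-asym (twice-< y<x)) ⟩
  B ∷ pairWord (doubleEdge e) (suc (twice y) ∷ [])        ≡⟨ cong (B ∷_) (pairWord-B∷ (doubleTail x xs) [] (<-asym (suc-twice-< y<x))) ⟩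
  B ∷ B ∷ pairWord (doubleEdge e) []                      ≡⟨ cong (λ w → B ∷ B ∷ w) (pairWord-[]ʳ (doubleEdge e)) ⟩
  B ∷ B ∷ constWord A (doubleEdge e)                      ≡⟨ cong (λ w → B ∷ B ∷ w) (sym (doubleLast-constWord A e)) ⟩
  B ∷ B ∷ doubleLast (constWord A e)                      ≡⟨ sym (doubleLast-∷-last {B} {constWord A e} (contains-constWord A e)) ⟩
  doubleLast (B ∷ pairWord e [])                          ≡⟨ cong doubleLast (sym (pairWord-B∷ xs [] x≮y)) ⟩
  doubleLast (pairWord e (y ∷ []))                        ∎
  where
  open ≡-Reasoning
  e = x ∷ xs
pairWord-doubleEdge∷ x xs (y ∷ f@(y′ ∷ ys)) e#f | tri> x≮y _ y<x = begin
  pairWord (doubleEdge e) (twice y ∷ doubleEdge f)        ≡⟨ pairWord-B∷ (doubleTail x xs) (doubleEdge f) (<-asym (twice-< y<x)) ⟩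
  B ∷ pairWord (doubleEdge e) (doubleEdge f)
    ≡⟨ cong (B ∷_) (pairWord-doubleEdge∷ x xs f (λ v v∈ v∈′ → e#f v v∈ (there v∈′))) ⟩
  B ∷ doubleLast (pairWord e f)                           ≡⟨ sym (doubleLast-∷-seen (contains-B-pairWord e y′ ys)) ⟩
  doubleLast (B ∷ pairWord e f)                           ≡⟨ cong doubleLast (sym (pairWord-B∷ xs f x≮y)) ⟩
  doubleLast (pairWord e (y ∷ f))                         ∎
  where
  open ≡-Reasoning
  e = x ∷ xs

doubleLift : ∀ {r} → 1 ≤ r → CliqueLift r doubleLast
doubleLift {r} 1≤r = record
  { lift          = λ _ → doubleEdge
  ; lift-edge     = edge
  ; lift-disjoint = λ {_} {e} {f} _ _ e#f v v∈ v∈′ → e#f (half v) (half-∈-doubleEdge e v∈) (half-∈-doubleEdge f v∈′)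
  ; lift-pairWord = λ {_} {e} {f} _ _ → pairWord-doubleEdge e f }
  where
  edge : ∀ {C e} → Bounded r C e → Edge (suc r) (doubleEdge e)
  edge {e = []}     ((r≡0 , _) , _)    = ⊥-elim (<⇒≢ 1≤r r≡0)
  edge {e = x ∷ xs} ((length≡ , e↑) , _) =
    cong suc (trans (length-doubleTail x xs) length≡) ,
    Linked⇒AllPairs <-trans (doubleTail-linked x xs (AllPairs⇒Linked e↑))

map-not-constWord : ∀ c f → map not (constWord c f) ≡ constWord (not c) f
map-not-constWord c []      = refl
map-not-constWord c (y ∷ f) = cong (not c ∷_) (map-not-constWord c f)

pairWord-swap  : ∀ e f → Disjoint e f → pairWord f e ≡ map not (pairWord e f)
pairWord-swap∷ : ∀ x xs f → Disjoint (x ∷ xs) f → pairWord f (x ∷ xs) ≡ map not (pairWord (x ∷ xs) f)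
pairWord-swap []       f = λ _ → trans (pairWord-[]ʳ f) (sym (map-not-constWord B f))
pairWord-swap (x ∷ xs) f = pairWord-swap∷ x xs f
pairWord-swap∷ x xs []       _   = sym (map-not-constWord A (x ∷ xs))
pairWord-swap∷ x xs (y ∷ ys) e#f with <-cmp x y
... | tri< x<y _ _ = begin
  pairWord (y ∷ ys) (x ∷ xs)          ≡⟨ pairWord-B∷ ys xs (<-asym x<y) ⟩
  B ∷ pairWord (y ∷ ys) xs            ≡⟨ cong (B ∷_) (pairWord-swap xs (y ∷ ys) (λ v v∈ → e#f v (there v∈))) ⟩
  B ∷ map not (pairWord xs (y ∷ ys))  ≡⟨ cong (map not) (sym (pairWord-A∷ xs ys x<y)) ⟩
  map not (pairWord (x ∷ xs) (y ∷ ys)) ∎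
  where open ≡-Reasoning
... | tri≈ _ x≡y _ = ⊥-elim (e#f x (here refl) (here x≡y))
... | tri> x≮y _ y<x = begin
  pairWord (y ∷ ys) (x ∷ xs)          ≡⟨ pairWord-A∷ ys xs y<x ⟩
  A ∷ pairWord ys (x ∷ xs)            ≡⟨ cong (A ∷_) (pairWord-swap∷ x xs ys (λ v v∈ v∈′ → e#f v v∈ (there v∈′))) ⟩
  A ∷ map not (pairWord (x ∷ xs) ys)  ≡⟨ cong (map not) (sym (pairWord-B∷ xs ys x≮y)) ⟩
  map not (pairWord (x ∷ xs) (y ∷ ys)) ∎
  where open ≡-Reasoning

_<head_ : ℕ → List ℕ → Set
x <head []      = ⊤
x <head (y ∷ _) = x < y

_≤head_ : ℕ → List ℕ → Set
y ≤head []      = ⊤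
y ≤head (x ∷ _) = y ≤ x

pairWord≡A∷ : ∀ e f {w} → pairWord e f ≡ A ∷ w → ∃ λ x → ∃ λ xs → e ≡ x ∷ xs × pairWord xs f ≡ w × x <head f
pairWord≡A∷ (x ∷ xs) [] e = x , xs , refl , trans (pairWord-[]ʳ xs) (∷-injectiveʳ e) , tt
pairWord≡A∷ (x ∷ xs) (y ∷ ys) e with x <ᵇ y | <ᵇ-reflects-< x y
... | true | ofʸ x<y = x , xs , refl , ∷-injectiveʳ e , x<y

pairWord≡B∷ : ∀ e f {w} → pairWord e f ≡ B ∷ w → ∃ λ y → ∃ λ ys → f ≡ y ∷ ys × pairWord e ys ≡ w × y ≤head e
pairWord≡B∷ [] (y ∷ ys) e = y , ys , refl , ∷-injectiveʳ e , tt
pairWord≡B∷ (x ∷ xs) (y ∷ ys) e with x <ᵇ y | <ᵇ-reflects-< x y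
... | false | ofⁿ x≮y = y , ys , refl , ∷-injectiveʳ e , ≮⇒≥ x≮y

pairWord≡B^n++ : ∀ n e f {w} → pairWord e f ≡ replicate n B ++ w →
  ∃ λ ys → ∃ λ f′ → f ≡ ys ++ f′ × length ys ≡ n × pairWord e f′ ≡ w
pairWord≡B^n++ zero    e f eq = [] , f , refl , refl , eq
pairWord≡B^n++ (suc n) e f eq
  with y , ys , refl , eq′ , _ ← pairWord≡B∷ e f eq
  with zs , f′ , refl , length≡ , eq″ ← pairWord≡B^n++ n e ys eq′ =
  y ∷ zs , f′ , refl , cong suc length≡ , eq″

contains-A-replicateB : ∀ n → contains A (replicate n B) ≡ false
contains-A-replicateB zero    = refl
contains-A-replicateB (suc n) = contains-A-replicateB n

pairWord≡B^n : ∀ n e f → pairWord e f ≡ replicate n B → e ≡ [] × length f ≡ n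
pairWord≡B^n n []       f eq = refl , trans (sym (length-map _ f)) (trans (cong length eq) (length-replicate n))
pairWord≡B^n n (x ∷ xs) f eq with () ← trans (sym (contains-A-pairWord x xs f)) (trans (cong (contains A) eq) (contains-A-replicateB n))

pairWord-split : ∀ e f α {β} → pairWord e f ≡ α ++ β →
  ∃ λ e₁ → ∃ λ e₂ → ∃ λ f₁ → ∃ λ f₂ → e ≡ e₁ ++ e₂ × f ≡ f₁ ++ f₂ × pairWord e₂ f₂ ≡ β
pairWord-split e f [] eq = [] , e , [] , f , refl , refl , eq
pairWord-split [] (y ∷ ys) (_ ∷ α) eq with e₁ , e₂ , f₁ , f₂ , e≡ , f≡ , eq′ ← pairWord-split [] ys α (∷-injectiveʳ eq) =
  e₁ , e₂ , y ∷ f₁ , f₂ , e≡ , cong (y ∷_) f≡ , eq′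
pairWord-split (x ∷ xs) [] (_ ∷ α) eq
  with e₁ , e₂ , f₁ , f₂ , e≡ , f≡ , eq′ ← pairWord-split xs [] α (trans (pairWord-[]ʳ xs) (∷-injectiveʳ eq)) =
  x ∷ e₁ , e₂ , f₁ , f₂ , cong (x ∷_) e≡ , f≡ , eq′
pairWord-split (x ∷ xs) (y ∷ ys) (_ ∷ α) eq with x <ᵇ y
... | true  with e₁ , e₂ , f₁ , f₂ , e≡ , f≡ , eq′ ← pairWord-split xs (y ∷ ys) α (∷-injectiveʳ eq) =
  x ∷ e₁ , e₂ , f₁ , f₂ , cong (x ∷_) e≡ , f≡ , eq′
... | false with e₁ , e₂ , f₁ , f₂ , e≡ , f≡ , eq′ ← pairWord-split (x ∷ xs) ys α (∷-injectiveʳ eq) =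
  e₁ , e₂ , y ∷ f₁ , f₂ , e≡ , cong (y ∷_) f≡ , eq′

TailWord : ℕ → ℕ → Word → Set
TailWord m k w = ∃ λ v → w ≡ v ++ A ∷ replicate (suc m) B ++ A ∷ replicate (2 + k) B

Tail : ℕ → ℕ → List ℕ → List ℕ → Set
Tail m k e f = TailWord m k (pairWord e f)

-- Read off the vertices at the two A's of the tail, the last two vertices of f, and the
-- vertex z of f opening the B-run after the first of those A's.
record TailFacts (m k : ℕ) (e f : List ℕ) : Set where
  field
    e-init : List ℕ
    p₁ p₂  : ℕ
    e≡     : e ≡ e-init ++ p₁ ∷ p₂ ∷ []
    f-init : List ℕ
    q₁ q₂  : ℕ
    f≡     : f ≡ f-init ++ q₁ ∷ q₂ ∷ []
    f-pre f-end : List ℕ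
    z      : ℕ
    f≡′    : f ≡ f-pre ++ z ∷ f-end
    length-f-end : length f-end ≡ m + (2 + k)
    p₁<z   : p₁ < z
    z≤p₂   : z ≤ p₂
    p₂<q₁  : p₂ < q₁
    q₁<q₂  : q₁ < q₂

AllPairs-++ʳ : ∀ xs {ys : List ℕ} → AllPairs _<_ (xs ++ ys) → AllPairs _<_ ys
AllPairs-++ʳ []       ys↑         = ys↑
AllPairs-++ʳ (x ∷ xs) (_ ∷ xs++ys↑) = AllPairs-++ʳ xs xs++ys↑

sorted-last-two : ∀ w w′ ws → AllPairs _<_ (w ∷ w′ ∷ ws) →
  ∃ λ init → ∃ λ q₁ → ∃ λ q₂ → w ∷ w′ ∷ ws ≡ init ++ q₁ ∷ q₂ ∷ [] × w ≤ q₁ × q₁ < q₂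
sorted-last-two w w′ []        ((w<w′ ∷ []) ∷ _) = [] , w , w′ , refl , ≤-refl , w<w′
sorted-last-two w w′ (w″ ∷ ws) ((w<w′ ∷ _) ∷ w′∷ws↑)
  with init , q₁ , q₂ , eq , w′≤q₁ , q₁<q₂ ← sorted-last-two w′ w″ ws w′∷ws↑ =
  w ∷ init , q₁ , q₂ , cong (w ∷_) eq , ≤-trans (<⇒≤ w<w′) w′≤q₁ , q₁<q₂

tail-facts : ∀ {m k e f} → AllPairs _<_ f → Tail m k e f → TailFacts m k e f
tail-facts {m} {k} {e} {f} f↑ (α , eq)
  with e₁ , e₂ , f₁ , f₂ , e≡ , f≡ , eq₂ ← pairWord-split e f α eq
  with p₁ , e₃ , refl , eq₃ , p₁<z ← pairWord≡A∷ e₂ f₂ eq₂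
  with z , f₃ , refl , eq₄ , z≤p₂ ← pairWord≡B∷ e₃ f₂ eq₃
  with ys , f₄ , refl , length-ys , eq₅ ← pairWord≡B^n++ m e₃ f₃ eq₄
  with p₂ , e₄ , refl , eq₆ , p₂<f₄ ← pairWord≡A∷ e₃ f₄ eq₅
  with refl , length-f₄ ← pairWord≡B^n (2 + k) e₄ f₄ eq₆
  with w ∷ w′ ∷ ws ← f₄
  with init , q₁ , q₂ , f₄≡ , w≤q₁ , q₁<q₂ ← sorted-last-two w w′ ws 
    (AllPairs-++ʳ (z ∷ ys) (AllPairs-++ʳ f₁ (subst (AllPairs _<_) f≡ f↑))) = record
  { e-init = e₁ ; p₁ = p₁ ; p₂ = p₂ ; e≡ = e≡
  ; f-init = (f₁ ++ z ∷ ys) ++ init ; q₁ = q₁ ; q₂ = q₂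
  ; f≡ = trans f≡′ (trans (cong ((f₁ ++ z ∷ ys) ++_) f₄≡) (sym (++-assoc (f₁ ++ z ∷ ys) init _)))
  ; f-pre = f₁ ; z = z ; f-end = ys ++ w ∷ w′ ∷ ws ; f≡′ = f≡
  ; length-f-end = trans (length-++ ys) (cong₂ _+_ length-ys length-f₄)
  ; p₁<z = p₁<z ; z≤p₂ = z≤p₂ ; p₂<q₁ = <-≤-trans p₂<f₄ w≤q₁ ; q₁<q₂ = q₁<q₂ }
  where
  f≡′ : f ≡ (f₁ ++ z ∷ ys) ++ w ∷ w′ ∷ ws
  f≡′ = trans f≡ (sym (++-assoc f₁ (z ∷ ys) _))

++-cancel-length : ∀ (xs ys : List ℕ) {K K′} → xs ++ K ≡ ys ++ K′ → length K ≡ length K′ → K ≡ K′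
++-cancel-length xs ys {K} {K′} xs++K≡ys++K′ length≡ =
  cancel xs ys (+-cancelʳ-≡ (length K′) (length xs) (length ys) lengths) xs++K≡ys++K′
  where
  lengths : length xs + length K′ ≡ length ys + length K′
  lengths = trans (cong (length xs +_) (sym length≡))
                  (trans (sym (length-++ xs)) (trans (cong length xs++K≡ys++K′) (length-++ ys)))
  cancel : ∀ xs ys → length xs ≡ length ys → xs ++ K ≡ ys ++ K′ → K ≡ K′
  cancel []       []       _  eq = eq
  cancel (x ∷ xs) (y ∷ ys) l≡ eq = cancel xs ys (suc-injective l≡) (∷-injectiveʳ eq)

last-two-unique : ∀ {e xs ys} {a b c d : ℕ} → e ≡ xs ++ a ∷ b ∷ [] → e ≡ ys ++ c ∷ d ∷ [] → a ≡ c × b ≡ d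
last-two-unique {xs = xs} {ys} e≡ e≡′ with refl ← ++-cancel-length xs ys (trans (sym e≡) e≡′) refl = refl , refl

no-tail-triangle : ∀ {m k a b d} → AllPairs _<_ b → AllPairs _<_ d → Tail m k a b → Tail m k b d → Tail m k a d → ⊥
no-tail-triangle {m} {k} {a} {b} {d} b↑ d↑ ab bd ad = <-irrefl refl (begin-strict
  T₃.z   ≤⟨ T₃.z≤p₂ ⟩
  T₃.p₂  ≡⟨ sym (proj₂ (last-two-unique T₁.e≡ T₃.e≡)) ⟩
  T₁.p₂  <⟨ T₁.p₂<q₁ ⟩
  T₁.q₁  ≡⟨ proj₁ (last-two-unique T₁.f≡ T₂.e≡) ⟩
  T₂.p₁  <⟨ T₂.p₁<z ⟩
  T₂.z   ≡⟨ ∷-injectiveˡ (++-cancel-length T₂.f-pre T₃.f-pre (trans (sym T₂.f≡′) T₃.f≡′)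
                           (cong suc (trans T₂.length-f-end (sym T₃.length-f-end)))) ⟩
  T₃.z   ∎)
  where
  open ≤-Reasoning
  module T₁ = TailFacts (tail-facts {m} {k} {a} b↑ ab)
  module T₂ = TailFacts (tail-facts {m} {k} {b} d↑ bd)
  module T₃ = TailFacts (tail-facts {m} {k} {a} d↑ ad)

no-tail-cycle : ∀ {m k a b d} → AllPairs _<_ a → AllPairs _<_ b → AllPairs _<_ d →
                Tail m k a b → Tail m k b d → Tail m k d a → ⊥
no-tail-cycle {m} {k} {a} {b} {d} a↑ b↑ d↑ ab bd da = <-irrefl refl (begin-strict
  T₁.p₂  <⟨ <-trans T₁.p₂<q₁ T₁.q₁<q₂ ⟩
  T₁.q₂  ≡⟨ proj₂ (last-two-unique T₁.f≡ T₂.e≡) ⟩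
  T₂.p₂  <⟨ <-trans T₂.p₂<q₁ T₂.q₁<q₂ ⟩
  T₂.q₂  ≡⟨ proj₂ (last-two-unique T₂.f≡ T₃.e≡) ⟩
  T₃.p₂  <⟨ <-trans T₃.p₂<q₁ T₃.q₁<q₂ ⟩
  T₃.q₂  ≡⟨ proj₂ (last-two-unique T₃.f≡ T₁.e≡) ⟩
  T₁.p₂  ∎)
  where
  open ≤-Reasoning
  module T₁ = TailFacts (tail-facts {m} {k} {a} b↑ ab)
  module T₂ = TailFacts (tail-facts {m} {k} {b} d↑ bd)
  module T₃ = TailFacts (tail-facts {m} {k} {d} a↑ da)

tournament₃ : ∀ {ℓ} (T : Fin 3 → Fin 3 → Set ℓ) → (∀ i j → i ≢ j → T i j ⊎ T j i) →
  ∃ λ a → ∃ λ b → ∃ λ d → T a b × T b d × (T d a ⊎ T a d)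
tournament₃ T orient with orient 0F 1F (λ ()) | orient 1F 2F (λ ()) | orient 0F 2F (λ ())
... | inj₁ t01 | inj₁ t12 | inj₁ t02 = 0F , 1F , 2F , t01 , t12 , inj₂ t02
... | inj₁ t01 | inj₁ t12 | inj₂ t20 = 0F , 1F , 2F , t01 , t12 , inj₁ t20
... | inj₁ t01 | inj₂ t21 | inj₁ t02 = 0F , 2F , 1F , t02 , t21 , inj₂ t01
... | inj₁ t01 | inj₂ t21 | inj₂ t20 = 2F , 0F , 1F , t20 , t01 , inj₂ t21
... | inj₂ t10 | inj₁ t12 | inj₁ t02 = 1F , 0F , 2F , t10 , t02 , inj₂ t12
... | inj₂ t10 | inj₁ t12 | inj₂ t20 = 1F , 2F , 0F , t12 , t20 , inj₂ t10
... | inj₂ t10 | inj₂ t21 | inj₁ t02 = 0F , 2F , 1F , t02 , t21 , inj₁ t10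
... | inj₂ t10 | inj₂ t21 | inj₂ t20 = 2F , 1F , 0F , t21 , t10 , inj₂ t20

tailWord-orientation : ∀ v c m k → let P = v ++ not c ∷ replicate (suc m) c ++ not c ∷ replicate (2 + k) c in
                       TailWord m k P ⊎ TailWord m k (map not P)
tailWord-orientation v B m k = inj₁ (v , refl)
tailWord-orientation v A m k = inj₂ (map not v , (begin
  map not (v ++ B ∷ replicate (suc m) A ++ B ∷ replicate (2 + k) A)
    ≡⟨ map-++ not v _ ⟩
  map not v ++ A ∷ map not (replicate (suc m) A ++ B ∷ replicate (2 + k) A)
    ≡⟨ cong (λ w → map not v ++ A ∷ w) (map-++ not (replicate (suc m) A) _) ⟩
  map not v ++ A ∷ map not (replicate (suc m) A) ++ A ∷ map not (replicate (2 + k) A)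
    ≡⟨ cong₂ (λ w w′ → map not v ++ A ∷ w ++ A ∷ w′) (map-replicate not (suc m) A) (map-replicate not (2 + k) A) ⟩
  map not v ++ A ∷ replicate (suc m) B ++ A ∷ replicate (2 + k) B ∎))
  where open ≡-Reasoning

tail-orientation : ∀ {m k P e f} → TailWord m k P ⊎ TailWord m k (map not P) → Disjoint e f →
                   normalize (pairWord e f) ≡ P → Tail m k e f ⊎ Tail m k f e
tail-orientation {m} {k} {P} {e} {f} tailP e#f normal≡P with normalize≡⇒ {pairWord e f} normal≡P | tailP
... | inj₁ ef≡P  | inj₁ tail = inj₁ (subst (TailWord m k) (sym ef≡P) tail)
... | inj₂ ef≡¬P | inj₂ tail = inj₁ (subst (TailWord m k) (sym ef≡¬P) tail)
... | inj₁ ef≡P  | inj₂ tail = inj₂ (subst (TailWord m k) (sym (trans (pairWord-swap e f e#f) (cong (map not) ef≡P))) tail)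
... | inj₂ ef≡¬P | inj₁ tail = inj₂ (subst (TailWord m k) (sym fe≡P) tail)
  where
  fe≡P : pairWord f e ≡ P
  fe≡P = trans (pairWord-swap e f e#f) (trans (cong (map not) ef≡¬P) (map-not-involutive P))

¬Collectable : ∀ r v c m k → ¬ Collectable r (v ++ not c ∷ replicate (suc m) c ++ not c ∷ replicate (2 + k) c)
¬Collectable r v c m k collectable
  with M , edge , disjoint , looks-like-P ← collectable 3 (s≤s (s≤s z≤n))
  with a , b , d , ab , bd , da⊎ad ← tournament₃ (λ i j → Tail m k (M i) (M j))
         (λ i j i≢j → tail-orientation (tailWord-orientation v c m k) (disjoint i j i≢j) (looks-like-P i j i≢j))
  with da⊎ad
... | inj₁ da = no-tail-cycle {m} {k} {M a} (sorted a) (sorted b) (sorted d) ab bd da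
  where sorted = λ i → proj₂ (edge i)
... | inj₂ ad = no-tail-triangle {m} {k} {M a} (sorted b) (sorted d) ab bd ad
  where sorted = λ i → proj₂ (edge i)

module Proposition {r Q} (1≤r : 1 ≤ r) (Q-pat : PatternFacts r Q) (split : LastRunSplit Q)
                   (Q-collectable : Collectable r Q) where
  open PatternFacts Q-pat
  open LastRunSplit split renaming (lastLetter to c; rest to u)
  open Children Q-pat split

  Q≡ : Q ≡ reverse u ++ not c ∷ replicate (suc t) c
  Q≡ = trans (reverse≡⇒ {Q} reverse≡) (reverse-runForm c t u)

  lastPair-Q : lastPair Q ≡ not c ∷ c ∷ []
  lastPair-Q = cong (λ d → not d ∷ d ∷ []) (begin
    lastOr A Q                                          ≡⟨ cong (lastOr A) (reverse≡⇒ {Q} reverse≡) ⟩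
    lastOr A (reverse (c ∷ replicate t c ++ not c ∷ u)) ≡⟨ cong (lastOr A) (unfold-reverse c (replicate t c ++ not c ∷ u)) ⟩
    lastOr A (reverse (replicate t c ++ not c ∷ u) ∷ʳ c) ≡⟨ lastOr-∷ʳ A (reverse (replicate t c ++ not c ∷ u)) c ⟩
    c                                                   ∎)
    where open ≡-Reasoning

  collectable₂ : Collectable (suc r) (reverse (shape₂ c t u))
  collectable₂ = subst (Collectable (suc r)) appended
    (Collectable-lift (MirrorLift.appendLift 1≤r) (MirrorLift.appendLast-map-not startsA) (startsWithA-++ _ startsA) Q-collectable)
    where
    appended : MirrorLift.appendLast Q ≡ reverse (shape₂ c t u)
    appended = begin
      Q ++ map not (lastPair Q)        ≡⟨ cong (λ w → Q ++ map not w) lastPair-Q ⟩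
      Q ++ not (not c) ∷ not c ∷ []
        ≡⟨ reverse≡⇒ (trans (reverse-++-∷ Q _ (_ ∷ [])) (cong (λ d → not c ∷ d ∷ reverse Q) (not-involutive c))) ⟩
      reverse (not c ∷ c ∷ reverse Q)  ≡⟨ cong (λ w → reverse (not c ∷ c ∷ w)) reverse≡ ⟩
      reverse (shape₂ c t u)           ∎
      where open ≡-Reasoning

  collectable₃ : Collectable (suc r) (reverse (shape₃ c t u))
  collectable₃ = subst (Collectable (suc r)) appended
    (Collectable-lift (ShiftLift.appendLift 1≤r) (ShiftLift.appendLast-map-not startsA) (startsWithA-++ _ startsA) Q-collectable)
    where
    appended : ShiftLift.appendLast Q ≡ reverse (shape₃ c t u)
    appended = begin
      Q ++ lastPair Q                  ≡⟨ cong (Q ++_) lastPair-Q ⟩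
      Q ++ not c ∷ c ∷ []              ≡⟨ reverse≡⇒ (reverse-++-∷ Q _ (_ ∷ [])) ⟩
      reverse (c ∷ not c ∷ reverse Q)  ≡⟨ cong (λ w → reverse (c ∷ not c ∷ w)) reverse≡ ⟩
      reverse (shape₃ c t u)           ∎
      where open ≡-Reasoning

  collectable₁ : Collectable (suc r) (reverse (shape₁ c t 0 u))
  collectable₁ = subst (Collectable (suc r)) doubled
    (Collectable-lift (doubleLift 1≤r) (doubleLast-map-not Q) (doubleLast-startsA startsA) Q-collectable)
    where
    doubled : doubleLast Q ≡ reverse (shape₁ c t 0 u)
    doubled = begin
      doubleLast Q                                             ≡⟨ cong doubleLast Q≡ ⟩
      doubleLast (reverse u ++ not c ∷ replicate (suc t) c)    ≡⟨ doubleLast-++ (reverse u) (contains-pair A c _) (contains-pair B c _) ⟩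
      reverse u ++ doubleLast (not c ∷ replicate (suc t) c)    ≡⟨ cong (reverse u ++_) (doubleLast-∷-last (contains-replicate c (suc t))) ⟩
      reverse u ++ not c ∷ not c ∷ doubleLast (replicate (suc t) c)
        ≡⟨ cong (λ w → reverse u ++ not c ∷ not c ∷ w) (doubleLast-replicate c t) ⟩
      reverse u ++ not c ∷ not c ∷ replicate (2 + t) c          ≡⟨ sym (reverse-shape₁ c t 0 u) ⟩
      reverse (shape₁ c t 0 u)                                 ∎
      where open ≡-Reasoning

  maturity-reverse : ∀ z → maturity (reverse z) ≡ firstRun z ∸ 2
  maturity-reverse z = cong (_∸ 2) (lastRun-reverse z)

  Shape-R₁-unique : t ≡ 0 → ∀ {z} → Shape c t u R₁ z → z ≡ shape₁ c t 0 u
  Shape-R₁-unique t≡0 shape with a , m , a+m≡t , refl ← Shape-R₁ shape =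
    cong₂ (λ a m → shape₁ c a m u) (trans (sym (+-identityʳ a)) (trans (cong (a +_) (sym m≡0)) a+m≡t)) m≡0
    where m≡0 = m+n≡0⇒n≡0 a (trans a+m≡t t≡0)

  part-i : ∀ R → (R ≡ R₂ ⊎ R ≡ R₃ ⊎ (R ≡ R₁ × lastRun Q ≡ 1)) →
           ∃ λ P → children (suc r) Q R ≡ P ∷ [] × Collectable (suc r) P × maturity P ≡ 0
  part-i R (inj₁ refl) = _ , children≡[ is₂ ] (λ { is₂ → refl }) , collectable₂ ,
                         trans (maturity-reverse (shape₂ c t u)) (cong (_∸ 2) (firstRun-shape₂ c t u))
  part-i R (inj₂ (inj₁ refl)) = _ , children≡[ is₃ ] (λ { is₃ → refl }) , collectable₃ ,
                                trans (maturity-reverse (shape₃ c t u)) (cong (_∸ 2) (firstRun-shape₃ c t u))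
  part-i R (inj₂ (inj₂ (refl , lastRun≡1))) = _ , children≡[ is₁ t 0 (+-identityʳ t) ] (Shape-R₁-unique t≡0) , collectable₁ ,
                                              trans (maturity-reverse (shape₁ c t 0 u)) (trans (cong (_∸ 2) (firstRun-shape₁ c t 0 u)) t≡0)
    where t≡0 = suc-injective (trans (sym lastRun≡) lastRun≡1)

  part-ii : 2 ≤ lastRun Q →
    length (children (suc r) Q R₁) ≡ lastRun Q ×
    (∃ λ P → P ∈ children (suc r) Q R₁ × Collectable (suc r) P ×
       (∀ P′ → P′ ∈ children (suc r) Q R₁ → Collectable (suc r) P′ → P′ ≡ P) ×
       maturity P ≡ lastRun Q ∸ 1 × maturity P ≡ maturity Q + 1)
  part-ii 2≤lastRun = trans length-children-R₁ (sym lastRun≡) ,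
    reverse (shape₁ c t 0 u) , Shape⇒∈-children (is₁ t 0 (+-identityʳ t)) , collectable₁ , only-collectable ,
    trans maturity≡t (cong (_∸ 1) (sym lastRun≡)) ,
    trans maturity≡t (trans (sym (m∸n+n≡m 1≤t)) (cong (λ n → n ∸ 2 + 1) (sym lastRun≡)))
    where
    1≤t : 1 ≤ t
    1≤t = ≤-pred (subst (2 ≤_) lastRun≡ 2≤lastRun)
    maturity≡t : maturity (reverse (shape₁ c t 0 u)) ≡ t
    maturity≡t = trans (maturity-reverse (shape₁ c t 0 u)) (cong (_∸ 2) (firstRun-shape₁ c t 0 u))
    only-collectable : ∀ P′ → P′ ∈ children (suc r) Q R₁ → Collectable (suc r) P′ → P′ ≡ reverse (shape₁ c t 0 u)
    only-collectable P′ P′∈ P′-collectable with a , m , a+m≡t , revP′≡ ← Shape-R₁ (∈-children⇒Shape P′∈) | m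
    ... | zero = trans (reverse≡⇒ revP′≡) (cong (λ a → reverse (shape₁ c a 0 u)) (trans (sym (+-identityʳ a)) a+m≡t))
    ... | suc m′ = ⊥-elim (¬Collectable (suc r) (reverse u) c m′ a
                     (subst (Collectable (suc r)) (trans (reverse≡⇒ revP′≡) (reverse-shape₁ c a (suc m′) u)) P′-collectable))

proposition2p3 : ∀ (r : ℕ) (Q : Word) → 3 ≤ r → IsPattern (r ∸ 1) Q → Collectable (r ∸ 1) Q →
    ((∀ (R : Word) → (R ≡ R₂ ⊎ R ≡ R₃ ⊎ (R ≡ R₁ × lastRun Q ≡ 1)) →
        ∃ λ (P : Word) → children r Q R ≡ P ∷ [] × Collectable r P × maturity P ≡ 0)
    ×
    (2 ≤ lastRun Q →
        length (children r Q R₁) ≡ lastRun Q ×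
        (∃ λ (P : Word) → P ∈ children r Q R₁ × Collectable r P ×
           (∀ (P′ : Word) → P′ ∈ children r Q R₁ → Collectable r P′ → P′ ≡ P) ×
           maturity P ≡ lastRun Q ∸ 1 × maturity P ≡ maturity Q + 1)))
proposition2p3 (suc r) Q (s≤s 2≤r) Q-pattern Q-collectable = part-i , part-ii
  where
  Q-pat : PatternFacts r Q
  Q-pat = IsPattern⇒ Q-pattern
  open Proposition (≤-trans (s≤s z≤n) 2≤r) Q-pat (lastRunSplit 2≤r Q-pat) Q-collectable
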